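{- Let $n\ge1$ and $\kappa>0$. For each $1\le i\le n$, the statistic $h^{\mathrm{B}}_i$ is multiplicatively $\kappa$-mesic with respect to the action of birational antichain rowmotion $\rho^{\mathrm{B}}_{\mathcal{A}}$ on $\mathcal{A}^{\mathrm{B}}_\kappa(\mathsf{A}^n)$; that is, for every finite $\rho^{\mathrm{B}}_{\mathcal{A}}$-orbit $O$, $\big(\prod_{\pi\in O}h^{\mathrm{B}}_i(\pi)\big)^{1/\#O}=\kappa$.
   Context: $\mathsf{A}^n$ is the poset of intervals $[i,j]=\{i,\dots,j\}$, $1\le i\le j\le n$, ordered by inclusion, graded with $\mathrm{rk}([i,j])=j-i$, rank $r=n-1$. $\mathcal{A}^{\mathrm{B}}_\kappa(\mathsf{A}^n)=\mathbb{R}_{>0}^{\mathsf{A}^n}$. Birational antichain toggle $\tau_p$ changes only the value at $p$, to $\kappa/\sum_C\prod_{y\in C}\pi(y)$, over maximal chains $C$ of $\mathsf{A}^n$ containing $p$; $\boldsymbol{\tau}_k=\prod_{\mathrm{rk}(p)=k}\tau_p$; $\rho^{\mathrm{B}}_{\mathcal{A}}=\boldsymbol{\tau}_r\cdots\boldsymbol{\tau}_1\boldsymbol{\tau}_0$ (rightmost applied first). $h^{\mathrm{B}}_i(\pi)=\prod_{i\le j\le n}\pi([i,j])\cdot\prod_{1\le j\le i}\pi([j,i])$. -}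

module Defs where

open import Data.Nat as ℕ using (ℕ; zero; suc; _∸_; _≡ᵇ_; _<?_; _≤?_; pred)
open import Data.Nat.Properties using (pred-mono-≤; pred[n]≤n; ≤-trans; ≤-refl)
open import Data.Bool using (Bool; true; false; if_then_else_; _∧_)
open import Data.List using (List; []; _∷_; [_]; map; foldr; foldl; filterᵇ; upTo; applyUpTo; mapMaybe; concatMap; _++_)
open import Data.Bool.ListAction using (any)
open import Data.Maybe using (Maybe; just; nothing)
open import Data.Product using (Σ; ∃; _×_; _,_)
open import Data.Sum using (_⊎_)
open import Relation.Nullary using (¬_; yes; no)
open import Relation.Binary.PropositionalEquality using (_≡_)
open import Relation.Binary.Structures using (IsStrictTotalOrder)
open import Algebra.Structures using (IsCommutativeRing)
open import Function using (_∘_)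

-- The real numbers, axiomatised as a complete ordered field.
-- (Every model is isomorphic to ℝ, so quantifying over all models is
-- the same as talking about ℝ.)

record CompleteOrderedField : Set₁ where
  infixl 7 _*_
  infixl 6 _+_
  infix 4 _<_ _≤_
  field
    Carrier : Set
    _+_ _*_ : Carrier → Carrier → Carrier
    -_      : Carrier → Carrier
    _⁻¹     : Carrier → Carrier
    0# 1#   : Carrier
    _<_     : Carrier → Carrier → Set
    isCommutativeRing    : IsCommutativeRing _≡_ _+_ _*_ -_ 0# 1#
    0≢1                  : ¬ (0# ≡ 1#)
    ⁻¹-inverseʳ          : ∀ x → ¬ (x ≡ 0#) → x * (x ⁻¹) ≡ 1#
    <-isStrictTotalOrder : IsStrictTotalOrder _≡_ _<_
    +-monoˡ-<            : ∀ {x y} z → x < y → x + z < y + z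
    *-pos                : ∀ {x y} → 0# < x → 0# < y → 0# < x * y

  _≤_ : Carrier → Carrier → Set
  x ≤ y = (x < y) ⊎ (x ≡ y)

  field
    complete : (S : Carrier → Set) → ∃ S → (∃ λ b → ∀ x → S x → x ≤ b) →
               ∃ λ s → (∀ x → S x → x ≤ s) × (∀ b → (∀ x → S x → x ≤ b) → s ≤ b)

-- The poset A^n of intervals [lo,hi] ⊆ {1..n}.

record Interval (n : ℕ) : Set where
  constructor interval
  field
    lo hi : ℕ
    1≤lo  : 1 ℕ.≤ lo
    lo≤hi : lo ℕ.≤ hi
    hi≤n  : hi ℕ.≤ n
open Interval public

rk : ∀ {n} → Interval n → ℕ
rk I = hi I ∸ lo I

sameI : ∀ {n} → Interval n → Interval n → Bool
sameI I J = (lo I ≡ᵇ lo J) ∧ (hi I ≡ᵇ hi J)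

mkInterval? : (n a b : ℕ) → Maybe (Interval n)
mkInterval? n a b with 1 ≤? a | a ≤? b | b ≤? n
... | yes p | yes q | yes r = just (interval a b p q r)
... | _     | _     | _     = nothing

allIntervals : (n : ℕ) → List (Interval n)
allIntervals n = concatMap (λ a → mapMaybe (mkInterval? n (suc a)) (applyUpTo suc n)) (upTo n)

-- the two intervals covered by [lo,hi] when lo < hi
shrinkL shrinkR : ∀ {n} (I : Interval n) → suc (lo I) ℕ.≤ hi I → Interval n
shrinkL (interval a b p q r) lt = interval (suc a) b (ℕ.s≤s ℕ.z≤n) lt r
shrinkR (interval a b p q r) lt = interval a (pred b) p (pred-mono-≤ lt) (≤-trans pred[n]≤n r)

-- saturated chains from I down to a minimal element (listed top-down),
-- using fuel
downChains : ∀ {n} → ℕ → Interval n → List (List (Interval n))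
downChains zero I = [ I ∷ [] ]
downChains (suc f) I with suc (lo I) ≤? hi I
... | no _   = [ I ∷ [] ]
... | yes lt = map (I ∷_) (downChains f (shrinkL I lt) ++ downChains f (shrinkR I lt))

top : (m : ℕ) → Interval (suc m)
top m = interval 1 (suc m) ≤-refl (ℕ.s≤s ℕ.z≤n) ≤-refl

-- all maximal chains of A^(suc m): every maximal chain contains the top
maximalChains : (m : ℕ) → List (List (Interval (suc m)))
maximalChains m = downChains (suc m) (top m)

module Rowmotion (F : CompleteOrderedField) where
  open CompleteOrderedField F

  _/_ : Carrier → Carrier → Carrier
  x / y = x * (y ⁻¹)

  Σ' : List Carrier → Carrier
  Σ' = foldr _+_ 0#

  Π' : List Carrier → Carrier
  Π' = foldr _*_ 1#

  _^_ : Carrier → ℕ → Carrier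
  x ^ zero  = 1#
  x ^ suc k = x * (x ^ k)

  Labelling : ℕ → Set
  Labelling n = Interval n → Carrier

  -- elements of A^B_κ(A^n) = ℝ_{>0}^{A^n}
  Positive : ∀ {n} → Labelling n → Set
  Positive π = ∀ p → 0# < π p

  _≈L_ : ∀ {n} → Labelling n → Labelling n → Set
  π ≈L σ = ∀ p → π p ≡ σ p

  module _ (m : ℕ) (κ : Carrier) where
    private n = suc m

    toggle : Interval n → Labelling n → Labelling n
    toggle p π q =
      if sameI p q
      then κ / Σ' (map (λ C → Π' (map π C)) (filterᵇ (any (sameI p)) (maximalChains m)))
      else π q

    -- 𝛕_k = product of τ_p over all p of rank k (these commute)
    rankToggle : ℕ → Labelling n → Labelling n
    rankToggle k π = foldr toggle π (filterᵇ (λ p → rk p ≡ᵇ k) (allIntervals n))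

    -- ρ = 𝛕_r ⋯ 𝛕_1 𝛕_0 (𝛕_0 applied first), r = n - 1 = m
    rowmotion : Labelling n → Labelling n
    rowmotion π = foldl (λ σ k → rankToggle k σ) π (upTo n)

    rowmotion^ : ℕ → Labelling n → Labelling n
    rowmotion^ zero    π = π
    rowmotion^ (suc l) π = rowmotion (rowmotion^ l π)

    h : ℕ → Labelling n → Carrier
    h i π = Π' (map π (filterᵇ (λ p → lo p ≡ᵇ i) (allIntervals n)))
          * Π' (map π (filterᵇ (λ p → hi p ≡ᵇ i) (allIntervals n)))

    -- the orbit of π when its exact period is k: π, ρπ, …, ρ^{k-1}π
    orbitList : ℕ → Labelling n → List (Labelling n)
    orbitList k π = applyUpTo (λ l → rowmotion^ l π) k

module Submission where

-- Splitting a maximal chain at p shows that the toggle at p divides κ by U(p)·D(p), where U(p) sums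
-- the weights of the chains from [1,n] down to p (p excluded) and D(p) those from p down to rank 0.
-- Rowmotion toggles rank by rank from the bottom, so with ρ = ρ(π) we get α(p)·β(p) = κ, where
-- α = D computed with ρ and β = π·U computed with π. Both satisfy Pascal-type recurrences,
--   α[a,b+1] = ρ[a,b+1]·(α[a+1,b+1] + α[a,b]),   β[a+1,b] = π[a+1,b]·(β[a,b] + β[a+1,b+1]),
-- which combine into the exchange relation ρ[a,b+1]·β[a,b+1]·β[a+1,b] = π[a+1,b]·β[a+1,b+1]·β[a,b].
-- Its product over the rectangle a < i ≤ b telescopes, and the boundary values of β are products of
-- π along the first row and the last column; the outcome is
--   h_i(π)·ρ[i,i]·Q(π) = κ·π[i,i]·Q(ρ),   Q(σ) = ∏_{a < i < b} σ[a,b],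
-- so along any orbit of period k (minimal or not) the factors σ[i,i] and Q(σ) cancel and ∏ h_i = κ^k.

open import Defs
open import Algebra.Bundles using (CommutativeRing)
import Algebra.Properties.Ring as RingProperties
import Algebra.Solver.Ring.NaturalCoefficients.Default as Solver
open import Data.Bool using (Bool; true; false; T; T?; _∧_; if_then_else_)
open import Data.Bool.ListAction using (any)
open import Data.Empty using (⊥; ⊥-elim)
open import Data.List using (List; []; _∷_; map; foldr; foldl; filterᵇ; _++_; concat; mapMaybe; applyUpTo; upTo)
import Data.List.Properties as List
open import Data.List.Membership.Propositional using (_∈_; _∉_)
open import Data.List.Membership.Propositional.Properties using (∈-concatMap⁺; ∈-upTo⁺; ∈-applyUpTo⁺; ∈-filter⁺; ∈-filter⁻)
open import Data.List.Relation.Unary.All as All using (All; []; _∷_)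
import Data.List.Relation.Unary.All.Properties as All
open import Data.List.Relation.Unary.AllPairs using ([]; _∷_)
import Data.List.Relation.Unary.AllPairs.Properties as AllPairs
open import Data.List.Relation.Unary.Any as Any using (here; there)
import Data.List.Relation.Unary.Any.Properties as Any
open import Data.List.Relation.Unary.Unique.Propositional using (Unique)
import Data.List.Relation.Unary.Unique.Propositional.Properties as Unique
open import Data.Maybe using (Maybe; just; nothing; maybe)
import Data.Maybe.Relation.Unary.All as Maybe
open import Data.Maybe.Relation.Unary.All using (just; nothing)
import Data.Maybe.Relation.Unary.Any as MaybeAny
open import Data.Maybe.Relation.Unary.Any using (just)
open import Data.Nat as ℕ using (ℕ; zero; suc; pred; _∸_; _≡ᵇ_; _≤?_; s≤s; z≤n)
import Data.Nat.Properties as ℕP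
open import Data.Product using (_×_; _,_; proj₁; proj₂)
open import Data.Sum using (_⊎_; inj₁; inj₂)
open import Data.Unit using (⊤)
open import Function using (_∘_)
open import Relation.Binary.Definitions using (tri<; tri≈; tri>)
open import Relation.Binary.PropositionalEquality
open import Relation.Binary.Structures using (IsStrictTotalOrder)
open import Relation.Nullary using (¬_; yes; no; Dec)
open import Relation.Nullary.Decidable using (_×-dec_)

mapMaybe-unique : ∀ {A B : Set} (f : A → Maybe B) → (∀ {x y z} → f x ≡ just z → f y ≡ just z → x ≡ y) →
                  ∀ {xs} → Unique xs → Unique (mapMaybe f xs)
mapMaybe-unique f inj {[]}     []           = []
mapMaybe-unique f inj {x ∷ xs} (x∉xs ∷ uxs) with f x in fx
... | nothing = mapMaybe-unique f inj uxs
... | just z  = fresh xs x∉xs ∷ mapMaybe-unique f inj uxs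
  where
  fresh : ∀ ys → All (x ≢_) ys → All (z ≢_) (mapMaybe f ys)
  fresh []       []           = []
  fresh (y ∷ ys) (x≢y ∷ x∉ys) with f y in fy
  ... | nothing = fresh ys x∉ys
  ... | just w  = (λ z≡w → x≢y (inj fx (trans fy (cong just (sym z≡w))))) ∷ fresh ys x∉ys

≡ᵇ-refl : ∀ c → (c ≡ᵇ c) ≡ true
≡ᵇ-refl zero    = refl
≡ᵇ-refl (suc c) = ≡ᵇ-refl c

rank-shrinkL : ∀ a b f → b ∸ a ℕ.≤ suc f → b ∸ suc a ℕ.≤ f
rank-shrinkL a b f rk≤ = subst (ℕ._≤ f) (ℕP.pred[m∸n]≡m∸[1+n] b a) (ℕP.pred-mono-≤ rk≤)

rank-shrinkR : ∀ a b f → b ∸ a ℕ.≤ suc f → pred b ∸ a ℕ.≤ f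
rank-shrinkR a zero    f _   = subst (ℕ._≤ f) (sym (ℕP.0∸n≡0 a)) z≤n
rank-shrinkR a (suc b) f rk≤ = rank-shrinkL a (suc b) f rk≤

rank≡0⇒≤ : ∀ {a b} → b ∸ a ℕ.≤ 0 → b ℕ.≤ a
rank≡0⇒≤ rk≤0 = ℕP.m∸n≡0⇒m≤n (ℕP.n≤0⇒n≡0 rk≤0)

n≰pred[n] : ∀ {b} → 1 ℕ.≤ b → ¬ b ℕ.≤ pred b
n≰pred[n] {suc b} _ = ℕP.1+n≰n

nested-rank-< : ∀ {a b c d} → a ℕ.≤ c → d ℕ.≤ b → c ℕ.≤ d → ¬ (c ≡ a × d ≡ b) → d ∸ c ℕ.< b ∸ a
nested-rank-< {a} {b} {c} {d} a≤c d≤b c≤d ≢ with a ℕ.<? c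
... | yes a<c = ℕP.<-≤-trans (ℕP.∸-monoʳ-< a<c c≤d) (ℕP.∸-monoˡ-≤ a d≤b)
... | no a≮c with ℕP.≤-antisym a≤c (ℕP.≮⇒≥ a≮c)
...   | refl with d ℕ.≟ b
...     | yes refl = ⊥-elim (≢ (refl , refl))
...     | no d≢b   = ℕP.∸-monoˡ-< (ℕP.≤∧≢⇒< d≤b d≢b) c≤d

nested-rank-≡ : ∀ {a b c d} → a ℕ.≤ c → d ℕ.≤ b → c ℕ.≤ d → d ∸ c ≡ b ∸ a → c ≡ a × d ≡ b
nested-rank-≡ {a} {b} {c} {d} a≤c d≤b c≤d rk≡ with (c ℕ.≟ a) ×-dec (d ℕ.≟ b)
... | yes same = same
... | no ≢     = ⊥-elim (ℕP.<-irrefl rk≡ (nested-rank-< a≤c d≤b c≤d ≢))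

swap-≢ : ∀ {a b c d : ℕ} → ¬ (a ≡ c × b ≡ d) → ¬ (c ≡ a × d ≡ b)
swap-≢ ≢ (e₁ , e₂) = ≢ (sym e₁ , sym e₂)

module _ {n : ℕ} where

  interval-≡ : ∀ {I J : Interval n} → lo I ≡ lo J → hi I ≡ hi J → I ≡ J
  interval-≡ {interval a b p q r} {interval .a .b p′ q′ r′} refl refl
    rewrite ℕP.≤-irrelevant p p′ | ℕP.≤-irrelevant q q′ | ℕP.≤-irrelevant r r′ = refl

  mkInterval?-endpoints : ∀ a b → Maybe.All (λ J → lo J ≡ a × hi J ≡ b) (mkInterval? n a b)
  mkInterval?-endpoints a b with 1 ≤? a | a ≤? b | b ≤? n
  ... | yes _ | yes _ | yes _ = just (refl , refl)
  ... | no _  | _     | _     = nothing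
  ... | yes _ | no _  | _     = nothing
  ... | yes _ | yes _ | no _  = nothing

  mkInterval?-complete : ∀ a b p q r → mkInterval? n a b ≡ just (interval a b p q r)
  mkInterval?-complete a b p q r with 1 ≤? a | a ≤? b | b ≤? n
  ... | yes _ | yes _ | yes _ = cong just (interval-≡ refl refl)
  ... | no ¬p | _     | _     = ⊥-elim (¬p p)
  ... | yes _ | no ¬q | _     = ⊥-elim (¬q q)
  ... | yes _ | yes _ | no ¬r = ⊥-elim (¬r r)

  rk<n : ∀ (q : Interval n) → rk q ℕ.< n
  rk<n q = ℕP.<-≤-trans (ℕP.∸-monoʳ-< {hi q} {lo q} {0} (1≤lo q) (lo≤hi q)) (hi≤n q)

  sameI⇒≡ : ∀ {I J : Interval n} → sameI I J ≡ true → I ≡ J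
  sameI⇒≡ {I} {J} eq with lo I ≡ᵇ lo J in e₁ | hi I ≡ᵇ hi J in e₂
  ... | true | true = interval-≡ (ℕP.≡ᵇ⇒≡ _ _ (subst T (sym e₁) _)) (ℕP.≡ᵇ⇒≡ _ _ (subst T (sym e₂) _))

  sameI-refl : ∀ (I : Interval n) → sameI I I ≡ true
  sameI-refl I rewrite ≡ᵇ-refl (lo I) | ≡ᵇ-refl (hi I) = refl

  private
    row : ℕ → List (Interval n)
    row a = mapMaybe (mkInterval? n (suc a)) (applyUpTo suc n)

    row-lo : ∀ a → All (λ J → lo J ≡ suc a) (row a)
    row-lo a = All.mapMaybe⁺ {xs = applyUpTo suc n}
      (All.map⁺ (All.universal (λ b → Maybe.map proj₁ (mkInterval?-endpoints (suc a) b)) (applyUpTo suc n)))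

    mkInterval?-injective : ∀ {a b b′ J} → mkInterval? n a b ≡ just J → mkInterval? n a b′ ≡ just J → b ≡ b′
    mkInterval?-injective {a} {b} {b′} e e′ = trans (sym (proj₂ (endpoints e))) (proj₂ (endpoints e′))
      where
      endpoints : ∀ {c J} → mkInterval? n a c ≡ just J → lo J ≡ a × hi J ≡ c
      endpoints {c} e = Maybe.drop-just (subst (Maybe.All _) e (mkInterval?-endpoints a c))

  allIntervals-unique : Unique (allIntervals n)
  allIntervals-unique = Unique.concat⁺
    (All.map⁺ (All.universal (λ a → mapMaybe-unique _ mkInterval?-injective
       (Unique.applyUpTo⁺₁ suc n (λ i<j _ → ℕP.<⇒≢ (s≤s i<j)))) _))
    (AllPairs.map⁺ (AllPairs.applyUpTo⁺₁ _ n (λ i<j _ (J∈row-i , J∈row-j) →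
       ℕP.<⇒≢ (s≤s i<j) (trans (sym (All.lookup (row-lo _) J∈row-i)) (All.lookup (row-lo _) J∈row-j)))))

  ∈-allIntervals : ∀ (J : Interval n) → J ∈ allIntervals n
  ∈-allIntervals J@(interval (suc a) b 1≤a a≤b b≤n) =
    ∈-concatMap⁺ row (Any.map (λ { refl → J∈row }) (∈-upTo⁺ (ℕP.≤-trans a≤b b≤n)))
    where
    b≡suc-pred-b : b ≡ suc (pred b)
    b≡suc-pred-b = sym (ℕP.suc-pred b {{ℕ.>-nonZero (ℕP.≤-trans 1≤a a≤b)}})
    b∈range : b ∈ applyUpTo suc n
    b∈range = subst (_∈ applyUpTo suc n) (sym b≡suc-pred-b) (∈-applyUpTo⁺ suc (subst (ℕ._≤ n) b≡suc-pred-b b≤n))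
    J∈row : J ∈ row a
    J∈row = Any.mapMaybe⁺ _ _ (Any.map⁺ (Any.map
              (λ { refl → subst (MaybeAny.Any (J ≡_)) (sym (mkInterval?-complete _ b 1≤a a≤b b≤n)) (just refl) }) b∈range))

  Nested : Interval n → Interval n → Set
  Nested J x = (lo J ℕ.≤ lo x × hi x ℕ.≤ hi J) ⊎ (lo x ℕ.≤ lo J × hi J ℕ.≤ hi x)

  nested-same-rank⇒≡ : ∀ J x → Nested J x → rk J ≡ rk x → J ≡ x
  nested-same-rank⇒≡ J x (inj₁ (lo≤ , ≤hi)) rk≡ with nested-rank-≡ lo≤ ≤hi (lo≤hi x) (sym rk≡)
  ... | lo≡ , hi≡ = interval-≡ (sym lo≡) (sym hi≡)
  nested-same-rank⇒≡ J x (inj₂ (lo≤ , ≤hi)) rk≡ with nested-rank-≡ lo≤ ≤hi (lo≤hi J) rk≡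
  ... | lo≡ , hi≡ = interval-≡ lo≡ hi≡

module FieldProperties (F : CompleteOrderedField) where
  open CompleteOrderedField F

  commutativeRing : CommutativeRing _ _
  commutativeRing = record { isCommutativeRing = isCommutativeRing }

  open CommutativeRing commutativeRing public
    using ( +-comm; +-assoc; *-comm; *-assoc; +-identityˡ; +-identityʳ; *-identityˡ; *-identityʳ
          ; distribˡ; distribʳ; zeroˡ; zeroʳ; -‿inverseʳ)
  open Solver (CommutativeRing.commutativeSemiring commutativeRing) public
    using (solve; _:=_; _:+_; _:*_)
  open IsStrictTotalOrder <-isStrictTotalOrder public
    using (compare; irrefl) renaming (trans to <-trans)
  open RingProperties (CommutativeRing.ring commutativeRing)
    using (-‿distribˡ-*; -‿distribʳ-*; -‿involutive)

  >0⇒≢0 : ∀ {x} → 0# < x → ¬ x ≡ 0#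
  >0⇒≢0 x>0 x≡0 = irrefl (sym x≡0) x>0

  +-pos : ∀ {x y} → 0# < x → 0# < y → 0# < x + y
  +-pos {x} {y} x>0 y>0 = <-trans y>0 (subst (_< x + y) (+-identityˡ y) (+-monoˡ-< y x>0))

  neg⇒-pos : ∀ {x} → x < 0# → 0# < - x
  neg⇒-pos {x} x<0 = subst₂ _<_ (-‿inverseʳ x) (+-identityˡ (- x)) (+-monoˡ-< (- x) x<0)

  x≢0⇒x*x>0 : ∀ x → ¬ x ≡ 0# → 0# < x * x
  x≢0⇒x*x>0 x x≢0 with compare 0# x
  ... | tri< x>0 _ _ = *-pos x>0 x>0
  ... | tri≈ _ 0≡x _ = ⊥-elim (x≢0 (sym 0≡x))
  ... | tri> _ _ x<0 = subst (0# <_) -x*-x≡x*x (*-pos (neg⇒-pos x<0) (neg⇒-pos x<0))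
    where
    -x*-x≡x*x : (- x) * (- x) ≡ x * x
    -x*-x≡x*x = trans (sym (-‿distribˡ-* x (- x)))
                (trans (cong -_ (sym (-‿distribʳ-* x x))) (-‿involutive (x * x)))

  0<1 : 0# < 1#
  0<1 = subst (0# <_) (*-identityˡ 1#) (x≢0⇒x*x>0 1# (λ 1≡0 → 0≢1 (sym 1≡0)))

  ⁻¹-pos : ∀ {x} → 0# < x → 0# < x ⁻¹
  ⁻¹-pos {x} x>0 with compare 0# (x ⁻¹)
  ... | tri< x⁻¹>0 _ _ = x⁻¹>0
  ... | tri≈ _ 0≡x⁻¹ _ =
    ⊥-elim (0≢1 (trans (sym (zeroʳ x)) (trans (cong (x *_) 0≡x⁻¹) (⁻¹-inverseʳ x (>0⇒≢0 x>0)))))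
  ... | tri> _ _ x⁻¹<0 = ⊥-elim (irrefl refl (subst (0# <_) (-‿inverseʳ 1#) (+-pos 0<1 -1>0)))
    where
    -1>0 : 0# < - 1#
    -1>0 = subst (λ y → 0# < - y) (⁻¹-inverseʳ x (>0⇒≢0 x>0))
             (subst (0# <_) (sym (-‿distribʳ-* x (x ⁻¹))) (*-pos x>0 (neg⇒-pos x⁻¹<0)))

  +-pos-≥0 : ∀ {x y} → 0# < x → 0# ≤ y → 0# < x + y
  +-pos-≥0 x>0 (inj₁ y>0)  = +-pos x>0 y>0
  +-pos-≥0 {x} x>0 (inj₂ refl) = subst (0# <_) (sym (+-identityʳ x)) x>0

  +-≥0-pos : ∀ {x y} → 0# ≤ x → 0# < y → 0# < x + y
  +-≥0-pos {x} {y} x≥0 y>0 = subst (0# <_) (+-comm y x) (+-pos-≥0 y>0 x≥0)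

  +-≥0 : ∀ {x y} → 0# ≤ x → 0# ≤ y → 0# ≤ x + y
  +-≥0 (inj₁ x>0) y≥0 = inj₁ (+-pos-≥0 x>0 y≥0)
  +-≥0 {y = y} (inj₂ refl) y≥0 = subst (0# ≤_) (sym (+-identityˡ y)) y≥0

  *-≥0 : ∀ {x y} → 0# ≤ x → 0# ≤ y → 0# ≤ x * y
  *-≥0 (inj₁ x>0) (inj₁ y>0) = inj₁ (*-pos x>0 y>0)
  *-≥0 {y = y} (inj₂ refl) _ = inj₂ (sym (zeroˡ y))
  *-≥0 {x} (inj₁ _) (inj₂ refl) = inj₂ (sym (zeroʳ x))

  x*y⁻¹*y≡x : ∀ x {y} → ¬ y ≡ 0# → x * y ⁻¹ * y ≡ x
  x*y⁻¹*y≡x x {y} y≢0 =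
    trans (*-assoc x _ y) (trans (cong (x *_) (trans (*-comm _ y) (⁻¹-inverseʳ y y≢0))) (*-identityʳ x))

  *-cancelʳ : ∀ {x y} z → ¬ z ≡ 0# → x * z ≡ y * z → x ≡ y
  *-cancelʳ {x} {y} z z≢0 xz≡yz = begin
    x
      ≡⟨ sym (x*y*y⁻¹ x) ⟩
    x * z * z ⁻¹
      ≡⟨ cong (_* z ⁻¹) xz≡yz ⟩
    y * z * z ⁻¹
      ≡⟨ x*y*y⁻¹ y ⟩
    y                ∎
    where
    open ≡-Reasoning
    x*y*y⁻¹ : ∀ w → w * z * z ⁻¹ ≡ w
    x*y*y⁻¹ w = trans (*-assoc w z _) (trans (cong (w *_) (⁻¹-inverseʳ z z≢0)) (*-identityʳ w))

module RangeProduct (F : CompleteOrderedField) where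
  open CompleteOrderedField F
  open Rowmotion F using (_^_)
  open FieldProperties F

  prod : (ℕ → Carrier) → ℕ → ℕ → Carrier
  prod f s zero    = 1#
  prod f s (suc c) = f s * prod f (suc s) c

  InRange : ℕ → ℕ → ℕ → Set
  InRange s c k = s ℕ.≤ k × k ℕ.< s ℕ.+ c

  private
    inRange-start : ∀ {s c} → InRange s (suc c) s
    inRange-start {s} {c} = ℕP.≤-refl , ℕP.≤-trans (s≤s (ℕP.m≤m+n s c)) (ℕP.≤-reflexive (sym (ℕP.+-suc s c)))

    inRange-suc : ∀ {s c k} → InRange (suc s) c k → InRange s (suc c) k
    inRange-suc {s} {c} (s<k , k<s+c) = ℕP.≤-trans (ℕP.n≤1+n s) s<k , ℕP.≤-trans k<s+c (ℕP.≤-reflexive (sym (ℕP.+-suc s c)))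

  prod-cong : ∀ {f g} s c → (∀ k → InRange s c k → f k ≡ g k) → prod f s c ≡ prod g s c
  prod-cong s zero    f≡g = refl
  prod-cong s (suc c) f≡g = cong₂ _*_ (f≡g s inRange-start) (prod-cong (suc s) c (λ k r → f≡g k (inRange-suc r)))

  prod-pos : ∀ {f} s c → (∀ k → InRange s c k → 0# < f k) → 0# < prod f s c
  prod-pos s zero    f>0 = 0<1
  prod-pos s (suc c) f>0 = *-pos (f>0 s inRange-start) (prod-pos (suc s) c (λ k r → f>0 k (inRange-suc r)))

  prod-≡1 : ∀ {f} s c → (∀ k → InRange s c k → f k ≡ 1#) → prod f s c ≡ 1#
  prod-≡1 s c f≡1 = trans (prod-cong s c f≡1) (prod-one s c)
    where
    prod-one : ∀ s c → prod (λ _ → 1#) s c ≡ 1#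
    prod-one s zero    = refl
    prod-one s (suc c) = trans (*-identityˡ _) (prod-one (suc s) c)

  prod-* : ∀ f g s c → prod (λ k → f k * g k) s c ≡ prod f s c * prod g s c
  prod-* f g s zero    = sym (*-identityˡ 1#)
  prod-* f g s (suc c) = trans (cong (f s * g s *_) (prod-* f g (suc s) c))
    (solve 4 (λ a b x y → a :* b :* (x :* y) := a :* x :* (b :* y)) refl (f s) (g s) (prod f (suc s) c) (prod g (suc s) c))

  prod-snoc : ∀ f s c → prod f s (suc c) ≡ prod f s c * f (s ℕ.+ c)
  prod-snoc f s zero    = trans (*-comm (f s) 1#) (cong (λ k → 1# * f k) (sym (ℕP.+-identityʳ s)))
  prod-snoc f s (suc c) = trans (cong (f s *_) (prod-snoc f (suc s) c))
    (trans (sym (*-assoc (f s) _ _)) (cong (λ k → f s * prod f (suc s) c * f k) (sym (ℕP.+-suc s c))))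

  prod-shift : ∀ f s c → prod f (suc s) c ≡ prod (f ∘ suc) s c
  prod-shift f s zero    = refl
  prod-shift f s (suc c) = cong (f (suc s) *_) (prod-shift f (suc s) c)

  prod-telescope : ∀ f s c → prod (f ∘ suc) s c * f s ≡ prod f s c * f (s ℕ.+ c)
  prod-telescope f s c = trans (cong (_* f s) (sym (prod-shift f s c))) (trans (*-comm _ (f s)) (prod-snoc f s c))

  prod-+ : ∀ f s c₁ c₂ → prod f s (c₁ ℕ.+ c₂) ≡ prod f s c₁ * prod f (s ℕ.+ c₁) c₂
  prod-+ f s zero     c₂ = trans (cong (λ t → prod f t c₂) (sym (ℕP.+-identityʳ s))) (sym (*-identityˡ _))
  prod-+ f s (suc c₁) c₂ = trans (cong (f s *_) (prod-+ f (suc s) c₁ c₂))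
    (trans (sym (*-assoc (f s) _ _)) (cong (λ t → f s * prod f (suc s) c₁ * prod f t c₂) (sym (ℕP.+-suc s c₁))))

  prod-const : ∀ x k → prod (λ _ → x) 0 k ≡ x ^ k
  prod-const x zero    = refl
  prod-const x (suc k) = cong (x *_) (trans (prod-shift (λ _ → x) 0 k) (prod-const x k))

  prod-single : ∀ f c₁ c₂ → (∀ k → k ℕ.< c₁ → f k ≡ 1#) → (∀ k → c₁ ℕ.< k → f k ≡ 1#) →
                prod f 0 (c₁ ℕ.+ suc c₂) ≡ f c₁
  prod-single f c₁ c₂ below above = begin
    prod f 0 (c₁ ℕ.+ suc c₂)
      ≡⟨ prod-+ f 0 c₁ (suc c₂) ⟩
    prod f 0 c₁ * (f c₁ * prod f (suc c₁) c₂)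
      ≡⟨ cong₂ (λ u v → u * (f c₁ * v)) (prod-≡1 0 c₁ (λ k r → below k (proj₂ r)))
                                   (prod-≡1 (suc c₁) c₂ (λ k r → above k (proj₁ r))) ⟩
    1# * (f c₁ * 1#)
      ≡⟨ trans (*-identityˡ _) (*-identityʳ _) ⟩
    f c₁ ∎
    where open ≡-Reasoning

  private
    prod-periodic : ∀ g k → 0# < g 0 → g k ≡ g 0 → prod (g ∘ suc) 0 k ≡ prod g 0 k
    prod-periodic g k g0>0 gk≡g0 =
      *-cancelʳ (g 0) (>0⇒≢0 g0>0) (trans (prod-telescope g 0 k) (cong (prod g 0 k *_) gk≡g0))

  prod-coboundary : ∀ (κ : Carrier) (x g q : ℕ → Carrier) k → (∀ l → 0# < g l) → (∀ l → 0# < q l) →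
                    g k ≡ g 0 → q k ≡ q 0 → (∀ l → x l * g (suc l) * q l ≡ κ * g l * q (suc l)) →
                    prod x 0 k ≡ κ ^ k
  prod-coboundary κ x g q k g>0 q>0 gk≡g0 qk≡q0 step = *-cancelʳ (G * Q) (>0⇒≢0 (*-pos G>0 Q>0)) (begin
    prod x 0 k * (G * Q)
      ≡⟨ cong (λ t → prod x 0 k * (t * Q)) (sym (prod-periodic g k (g>0 0) gk≡g0)) ⟩
    prod x 0 k * (prod (g ∘ suc) 0 k * Q)
      ≡⟨ solve 3 (λ a b c → a :* (b :* c) := a :* b :* c) refl (prod x 0 k) _ Q ⟩
    prod x 0 k * prod (g ∘ suc) 0 k * Q
      ≡⟨ trans (cong (_* Q) (sym (prod-* x (g ∘ suc) 0 k))) (sym (prod-* _ q 0 k)) ⟩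
    prod (λ l → x l * g (suc l) * q l) 0 k
      ≡⟨ prod-cong 0 k (λ l _ → step l) ⟩
    prod (λ l → κ * g l * q (suc l)) 0 k
      ≡⟨ trans (prod-* _ (q ∘ suc) 0 k) (cong (_* prod (q ∘ suc) 0 k) (prod-* _ g 0 k)) ⟩
    prod (λ _ → κ) 0 k * G * prod (q ∘ suc) 0 k
      ≡⟨ cong₂ (λ u v → u * G * v) (prod-const κ k) (prod-periodic q k (q>0 0) qk≡q0) ⟩
    κ ^ k * G * Q
      ≡⟨ *-assoc (κ ^ k) G Q ⟩
    κ ^ k * (G * Q) ∎)
    where
    open ≡-Reasoning
    G Q : Carrier
    G = prod g 0 k
    Q = prod q 0 k
    G>0 : 0# < G
    G>0 = prod-pos 0 k (λ l _ → g>0 l)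
    Q>0 : 0# < Q
    Q>0 = prod-pos 0 k (λ l _ → q>0 l)

  prod-exchange : ∀ (u v g h : ℕ → Carrier) s c → (∀ k → InRange s c k → 0# < g k) → (∀ k → InRange s c k → 0# < h k) →
                  (∀ k → InRange s c k → u k * g k * h (suc k) ≡ v k * g (suc k) * h k) →
                  prod u s c * g s * h (s ℕ.+ c) ≡ prod v s c * g (s ℕ.+ c) * h s
  prod-exchange u v g h s c g>0 h>0 step = *-cancelʳ (G * H) (>0⇒≢0 (*-pos (prod-pos s c g>0) (prod-pos s c h>0))) (begin
    prod u s c * g s * h (s ℕ.+ c) * (G * H)
      ≡⟨ solve 5 (λ U x y G H → U :* x :* y :* (G :* H) := U :* G :* (H :* y) :* x) refl (prod u s c) (g s) (h (s ℕ.+ c)) G H ⟩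
    prod u s c * G * (H * h (s ℕ.+ c)) * g s
      ≡⟨ cong (λ t → prod u s c * G * t * g s) (sym (prod-telescope h s c)) ⟩
    prod u s c * G * (prod (h ∘ suc) s c * h s) * g s
      ≡⟨ solve 5 (λ U G H′ y x → U :* G :* (H′ :* y) :* x := U :* G :* H′ :* (y :* x)) refl (prod u s c) G _ (h s) (g s) ⟩
    prod u s c * G * prod (h ∘ suc) s c * (h s * g s)
      ≡⟨ cong (_* (h s * g s)) products ⟩
    prod v s c * prod (g ∘ suc) s c * H * (h s * g s)
      ≡⟨ solve 5 (λ V G′ H y x → V :* G′ :* H :* (y :* x) := V :* (G′ :* x) :* H :* y) refl (prod v s c) _ H (h s) (g s) ⟩
    prod v s c * (prod (g ∘ suc) s c * g s) * H * h s
      ≡⟨ cong (λ t → prod v s c * t * H * h s) (prod-telescope g s c) ⟩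
    prod v s c * (G * g (s ℕ.+ c)) * H * h s
      ≡⟨ solve 5 (λ V G x H y → V :* (G :* x) :* H :* y := V :* x :* y :* (G :* H)) refl (prod v s c) G (g (s ℕ.+ c)) H (h s) ⟩
    prod v s c * g (s ℕ.+ c) * h s * (G * H) ∎)
    where
    open ≡-Reasoning
    G H : Carrier
    G = prod g s c
    H = prod h s c
    products : prod u s c * G * prod (h ∘ suc) s c ≡ prod v s c * prod (g ∘ suc) s c * H
    products = begin
      prod u s c * G * prod (h ∘ suc) s c
        ≡⟨ cong (_* prod (h ∘ suc) s c) (sym (prod-* u g s c)) ⟩
      prod (λ k → u k * g k) s c * prod (h ∘ suc) s c
        ≡⟨ sym (prod-* _ (h ∘ suc) s c) ⟩
      prod (λ k → u k * g k * h (suc k)) s c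
        ≡⟨ prod-cong s c step ⟩
      prod (λ k → v k * g (suc k) * h k) s c
        ≡⟨ prod-* _ h s c ⟩
      prod (λ k → v k * g (suc k)) s c * H
        ≡⟨ cong (_* H) (prod-* v (g ∘ suc) s c) ⟩
      prod v s c * prod (g ∘ suc) s c * H ∎

module ChainSums (F : CompleteOrderedField) {n : ℕ} where
  open CompleteOrderedField F
  open Rowmotion F
  open FieldProperties F

  -- 0 is a junk value, returned when [a,b] is not an interval of A^n.
  at : Labelling n → ℕ → ℕ → Carrier
  at σ a b = maybe σ 0# (mkInterval? n a b)

  at-interval : ∀ σ a b p q r → at σ a b ≡ σ (interval a b p q r)
  at-interval σ a b p q r rewrite mkInterval?-complete a b p q r = refl

  at-lo-hi : ∀ σ (I : Interval n) → at σ (lo I) (hi I) ≡ σ I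
  at-lo-hi σ (interval a b p q r) = at-interval σ a b p q r

  downSum : Labelling n → ℕ → ℕ → ℕ → Carrier
  downSum σ zero    a b = at σ a b
  downSum σ (suc f) a b with suc a ≤? b
  ... | yes _ = at σ a b * (downSum σ f (suc a) b + downSum σ f a (pred b))
  ... | no _  = at σ a b

  downWeight : Labelling n → ℕ → ℕ → Carrier
  downWeight σ a b = downSum σ (b ∸ a) a b

  chainsWeight : Labelling n → List (List (Interval n)) → Carrier
  chainsWeight σ Cs = Σ' (map (Π' ∘ map σ) Cs)

  chainsWeight-∷ : ∀ σ I Cs → chainsWeight σ (map (I ∷_) Cs) ≡ σ I * chainsWeight σ Cs
  chainsWeight-∷ σ I []       = sym (zeroʳ _)
  chainsWeight-∷ σ I (C ∷ Cs) = trans (cong (σ I * Π' (map σ C) +_) (chainsWeight-∷ σ I Cs)) (sym (distribˡ (σ I) _ _))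

  chainsWeight-++ : ∀ σ Cs Ds → chainsWeight σ (Cs ++ Ds) ≡ chainsWeight σ Cs + chainsWeight σ Ds
  chainsWeight-++ σ []       Ds = sym (+-identityˡ _)
  chainsWeight-++ σ (C ∷ Cs) Ds = trans (cong (Π' (map σ C) +_) (chainsWeight-++ σ Cs Ds)) (sym (+-assoc _ _ _))

  chainsWeight-downChains : ∀ σ f I → chainsWeight σ (downChains f I) ≡ downSum σ f (lo I) (hi I)
  chainsWeight-downChains σ zero    I = trans (+-identityʳ _) (trans (*-identityʳ _) (sym (at-lo-hi σ I)))
  chainsWeight-downChains σ (suc f) I@(interval a b p q r) with suc a ≤? b
  ... | no _   = trans (+-identityʳ _) (trans (*-identityʳ _) (sym (at-lo-hi σ I)))
  ... | yes lt = begin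
    chainsWeight σ (map (I ∷_) (downChains f L ++ downChains f R))
      ≡⟨ chainsWeight-∷ σ I (downChains f L ++ downChains f R) ⟩
    σ I * chainsWeight σ (downChains f L ++ downChains f R)
      ≡⟨ cong (σ I *_) (chainsWeight-++ σ (downChains f L) (downChains f R)) ⟩
    σ I * (chainsWeight σ (downChains f L) + chainsWeight σ (downChains f R))
      ≡⟨ cong₂ _*_ (sym (at-lo-hi σ I)) (cong₂ _+_ (chainsWeight-downChains σ f L) (chainsWeight-downChains σ f R)) ⟩
    at σ a b * (downSum σ f (suc a) b + downSum σ f a (pred b)) ∎
    where
    open ≡-Reasoning
    L R : Interval n
    L = shrinkL I lt
    R = shrinkR I lt

  downSum-fuel : ∀ σ f g a b → b ∸ a ℕ.≤ f → b ∸ a ℕ.≤ g → downSum σ f a b ≡ downSum σ g a b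
  downSum-fuel σ zero    zero    a b _   _   = refl
  downSum-fuel σ zero    (suc g) a b rk≤f _ with suc a ≤? b
  ... | yes a<b = ⊥-elim (ℕP.<⇒≱ a<b (rank≡0⇒≤ rk≤f))
  ... | no _    = refl
  downSum-fuel σ (suc f) zero    a b _ rk≤g with suc a ≤? b
  ... | yes a<b = ⊥-elim (ℕP.<⇒≱ a<b (rank≡0⇒≤ rk≤g))
  ... | no _    = refl
  downSum-fuel σ (suc f) (suc g) a b rk≤f rk≤g with suc a ≤? b
  ... | yes _ = cong (at σ a b *_) (cong₂ _+_
                  (downSum-fuel σ f g (suc a) b (rank-shrinkL a b f rk≤f) (rank-shrinkL a b g rk≤g))
                  (downSum-fuel σ f g a (pred b) (rank-shrinkR a b f rk≤f) (rank-shrinkR a b g rk≤g)))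
  ... | no _  = refl

  mutual
    -- Total weight of the chains from [a,b] down to [c,d], where a chain weighs the product of σ
    -- over its elements other than [c,d].
    upSum : Labelling n → (c d f a b : ℕ) → Carrier
    upSum σ c d f a b = upSumUnless σ c d f a b ((c ≡ᵇ a) ∧ (d ≡ᵇ b))

    upSumUnless : Labelling n → (c d f a b : ℕ) → Bool → Carrier
    upSumUnless σ c d f       a b true  = 1#
    upSumUnless σ c d zero    a b false = 0#
    upSumUnless σ c d (suc f) a b false = upSumStep σ c d f a b (suc a ≤? b)

    upSumStep : Labelling n → (c d f a b : ℕ) → Dec (suc a ℕ.≤ b) → Carrier
    upSumStep σ c d f a b (yes _) = at σ a b * (upSum σ c d f (suc a) b + upSum σ c d f a (pred b))
    upSumStep σ c d f a b (no _)  = 0#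

  throughSum : Labelling n → Interval n → ℕ → Interval n → Carrier
  throughSum σ p f I = chainsWeight σ (filterᵇ (any (sameI p)) (downChains f I))

  private
    filter-∷-through : ∀ p I → sameI p I ≡ true → (Cs : List (List (Interval n))) →
                       filterᵇ (any (sameI p)) (map (I ∷_) Cs) ≡ map (I ∷_) Cs
    filter-∷-through p I p≡I []       = refl
    filter-∷-through p I p≡I (C ∷ Cs) rewrite p≡I = cong ((I ∷ C) ∷_) (filter-∷-through p I p≡I Cs)

    filter-∷-past : ∀ p I → sameI p I ≡ false → (Cs : List (List (Interval n))) →
                    filterᵇ (any (sameI p)) (map (I ∷_) Cs) ≡ map (I ∷_) (filterᵇ (any (sameI p)) Cs)
    filter-∷-past p I p≢I []       = refl
    filter-∷-past p I p≢I (C ∷ Cs) rewrite p≢I with any (sameI p) C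
    ... | true  = cong ((I ∷ C) ∷_) (filter-∷-past p I p≢I Cs)
    ... | false = filter-∷-past p I p≢I Cs

  throughSum-split : ∀ σ p f I → rk I ℕ.≤ f →
                     throughSum σ p f I ≡ upSum σ (lo p) (hi p) f (lo I) (hi I) * downWeight σ (lo p) (hi p)
  throughSum-split σ p f I rk≤f with sameI p I in p≟I
  ... | true = begin
    throughSum σ p f I
      ≡⟨ cong (chainsWeight σ) (all-through f) ⟩
    chainsWeight σ (downChains f I)
      ≡⟨ chainsWeight-downChains σ f I ⟩
    downSum σ f (lo I) (hi I)
      ≡⟨ downSum-fuel σ f (rk I) _ _ rk≤f ℕP.≤-refl ⟩
    downWeight σ (lo I) (hi I)
      ≡⟨ cong (λ J → downWeight σ (lo J) (hi J)) (sym (sameI⇒≡ {I = p} {J = I} p≟I)) ⟩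
    downWeight σ (lo p) (hi p)
      ≡⟨ sym (*-identityˡ _) ⟩
    1# * downWeight σ (lo p) (hi p) ∎
    where
    open ≡-Reasoning
    all-through : ∀ f → filterᵇ (any (sameI p)) (downChains f I) ≡ downChains f I
    all-through zero rewrite p≟I = refl
    all-through (suc f) with suc (lo I) ≤? hi I
    ... | no _ rewrite p≟I = refl
    ... | yes _ = filter-∷-through p I p≟I _
  ... | false = past f I rk≤f p≟I
    where
    open ≡-Reasoning
    D : Carrier
    D = downWeight σ (lo p) (hi p)
    past : ∀ f I → rk I ℕ.≤ f → sameI p I ≡ false →
           throughSum σ p f I ≡ upSumUnless σ (lo p) (hi p) f (lo I) (hi I) false * D
    past zero I _ p≢I rewrite p≢I = sym (zeroˡ _)
    past (suc f) I@(interval a b _ _ _) rk≤f p≢I with suc a ≤? b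
    ... | no _ rewrite p≢I = sym (zeroˡ _)
    ... | yes lt = begin
      chainsWeight σ (through (map (I ∷_) (downChains f L ++ downChains f R)))
        ≡⟨ cong (chainsWeight σ) (trans (filter-∷-past p I p≢I (downChains f L ++ downChains f R))
                                        (cong (map (I ∷_)) (List.filter-++ (T? ∘ any (sameI p)) (downChains f L) (downChains f R)))) ⟩
      chainsWeight σ (map (I ∷_) (through (downChains f L) ++ through (downChains f R)))
        ≡⟨ chainsWeight-∷ σ I (through (downChains f L) ++ through (downChains f R)) ⟩
      σ I * chainsWeight σ (through (downChains f L) ++ through (downChains f R))
        ≡⟨ cong (σ I *_) (chainsWeight-++ σ (through (downChains f L)) (through (downChains f R))) ⟩
      σ I * (throughSum σ p f L + throughSum σ p f R)
        ≡⟨ cong₂ _*_ (sym (at-lo-hi σ I)) (cong₂ _+_ (throughSum-split σ p f L (rank-shrinkL a b f rk≤f))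
                                                  (throughSum-split σ p f R (rank-shrinkR a b f rk≤f))) ⟩
      at σ a b * (upSum σ (lo p) (hi p) f (suc a) b * D + upSum σ (lo p) (hi p) f a (pred b) * D)
        ≡⟨ solve 4 (λ x u v d → x :* (u :* d :+ v :* d) := x :* (u :+ v) :* d) refl (at σ a b) _ _ D ⟩
      at σ a b * (upSum σ (lo p) (hi p) f (suc a) b + upSum σ (lo p) (hi p) f a (pred b)) * D ∎
      where
      through : List (List (Interval n)) → List (List (Interval n))
      through = filterᵇ (any (sameI p))
      L R : Interval n
      L = shrinkL I lt
      R = shrinkR I lt

  upSum-target : ∀ σ c d f → upSum σ c d f c d ≡ 1#
  upSum-target σ c d f rewrite ≡ᵇ-refl c | ≡ᵇ-refl d = refl

  upSum-≢ : ∀ σ c d f a b → ¬ (c ≡ a × d ≡ b) → upSum σ c d f a b ≡ upSumUnless σ c d f a b false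
  upSum-≢ σ c d f a b ≢ = cong (upSumUnless σ c d f a b) (≡ᵇ∧≡ᵇ-false ≢)
    where
    ≡ᵇ∧≡ᵇ-false : ∀ {c d a b} → ¬ (c ≡ a × d ≡ b) → (c ≡ᵇ a) ∧ (d ≡ᵇ b) ≡ false
    ≡ᵇ∧≡ᵇ-false {c} {d} {a} {b} ≢ with c ≡ᵇ a in e₁ | d ≡ᵇ b in e₂
    ... | false | _     = refl
    ... | true  | false = refl
    ... | true  | true  = ⊥-elim (≢ (ℕP.≡ᵇ⇒≡ c a (subst T (sym e₁) _) , ℕP.≡ᵇ⇒≡ d b (subst T (sym e₂) _)))

  upSum-outside : ∀ σ c d f a b → (a ℕ.≤ c → d ℕ.≤ b → ⊥) → upSum σ c d f a b ≡ 0#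
  upSum-outside σ c d f a b ∉ = trans (upSum-≢ σ c d f a b (λ { (refl , refl) → ∉ ℕP.≤-refl ℕP.≤-refl })) (go f)
    where
    go : ∀ f → upSumUnless σ c d f a b false ≡ 0#
    go zero = refl
    go (suc f) with suc a ≤? b
    ... | no _  = refl
    ... | yes _ = trans (cong (at σ a b *_) (cong₂ _+_
                    (upSum-outside σ c d f (suc a) b (λ a<c → ∉ (ℕP.<⇒≤ a<c)))
                    (upSum-outside σ c d f a (pred b) (λ a≤c d≤b-1 → ∉ a≤c (ℕP.≤-trans d≤b-1 ℕP.pred[n]≤n)))))
                  (trans (cong (at σ a b *_) (+-identityˡ 0#)) (zeroʳ _))

  -- The last step of a chain into [c+1,d] leaves one of the two upper covers [c,d] and [c+1,d+1].
  upSum-rec : ∀ σ f a b c d → suc c ℕ.≤ d → ¬ (suc c ≡ a × d ≡ b) → b ∸ a ℕ.≤ f →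
              upSum σ (suc c) d f a b ≡ at σ c d * upSum σ c d f a b + at σ (suc c) (suc d) * upSum σ (suc c) (suc d) f a b
  upSum-rec σ zero a b c d c<d ≢ rk≤0 = begin
    upSum σ (suc c) d 0 a b
      ≡⟨ upSum-≢ σ (suc c) d 0 a b ≢ ⟩
    0#
      ≡⟨ sym (x*0+y*0≡0 _ _) ⟩
    at σ c d * 0# + at σ (suc c) (suc d) * 0#
      ≡⟨ sym (cong₂ _+_ (cong (at σ c d *_) (upSum-≢ σ c d 0 a b (≢top c<d)))
                        (cong (at σ (suc c) (suc d) *_) (upSum-≢ σ (suc c) (suc d) 0 a b (≢top (s≤s c<d))))) ⟩
    at σ c d * upSum σ c d 0 a b + at σ (suc c) (suc d) * upSum σ (suc c) (suc d) 0 a b ∎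
    where
    open ≡-Reasoning
    x*0+y*0≡0 : ∀ x y → x * 0# + y * 0# ≡ 0#
    x*0+y*0≡0 x y = trans (cong₂ _+_ (zeroʳ x) (zeroʳ y)) (+-identityˡ 0#)
    ≢top : ∀ {c′ d′} → c′ ℕ.< d′ → ¬ (c′ ≡ a × d′ ≡ b)
    ≢top c′<d′ (refl , refl) = ℕP.<⇒≱ c′<d′ (rank≡0⇒≤ rk≤0)
  upSum-rec σ (suc f) a b c d c<d ≢ rk≤ with (c ℕ.≟ a) ×-dec (d ℕ.≟ b) | (suc c ℕ.≟ a) ×-dec (suc d ℕ.≟ b)
  upSum-rec σ (suc f) a b .a .b c<d ≢ rk≤ | yes (refl , refl) | _
    rewrite upSum-≢ σ (suc a) b (suc f) a b ≢ with suc a ≤? b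
  ... | no a≮b = ⊥-elim (a≮b c<d)
  ... | yes a<b = begin
    at σ a b * (upSum σ (suc a) b f (suc a) b + upSum σ (suc a) b f a (pred b))
      ≡⟨ cong (at σ a b *_) (cong₂ _+_ (upSum-target σ (suc a) b f)
           (upSum-outside σ (suc a) b f a (pred b) (λ _ → n≰pred[n] (ℕP.≤-trans (s≤s z≤n) a<b)))) ⟩
    at σ a b * (1# + 0#)
      ≡⟨ trans (distribˡ _ 1# 0#) (cong (at σ a b * 1# +_) (trans (zeroʳ _) (sym (zeroʳ (at σ (suc a) (suc b)))))) ⟩
    at σ a b * 1# + at σ (suc a) (suc b) * 0#
      ≡⟨ sym (cong₂ _+_ (cong (at σ a b *_) (upSum-target σ a b (suc f)))
           (cong (at σ (suc a) (suc b) *_) (upSum-outside σ (suc a) (suc b) (suc f) a b (λ _ → ℕP.<⇒≱ (ℕP.n<1+n b))))) ⟩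
    at σ a b * upSum σ a b (suc f) a b + at σ (suc a) (suc b) * upSum σ (suc a) (suc b) (suc f) a b ∎
    where open ≡-Reasoning
  upSum-rec σ (suc f) .(suc c) .(suc d) c d c<d ≢ rk≤ | no _ | yes (refl , refl)
    rewrite upSum-≢ σ (suc c) d (suc f) (suc c) (suc d) ≢ with suc (suc c) ≤? suc d
  ... | no c≮d = ⊥-elim (c≮d (s≤s c<d))
  ... | yes _ = begin
    at σ (suc c) (suc d) * (upSum σ (suc c) d f (suc (suc c)) (suc d) + upSum σ (suc c) d f (suc c) d)
      ≡⟨ cong (at σ (suc c) (suc d) *_) (cong₂ _+_
           (upSum-outside σ (suc c) d f (suc (suc c)) (suc d) (λ c+2≤c+1 _ → ℕP.1+n≰n c+2≤c+1)) (upSum-target σ (suc c) d f)) ⟩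
    at σ (suc c) (suc d) * (0# + 1#)
      ≡⟨ trans (distribˡ _ 0# 1#) (cong (_+ at σ (suc c) (suc d) * 1#) (trans (zeroʳ _) (sym (zeroʳ (at σ c d))))) ⟩
    at σ c d * 0# + at σ (suc c) (suc d) * 1#
      ≡⟨ sym (cong₂ _+_ (cong (at σ c d *_) (upSum-outside σ c d (suc f) (suc c) (suc d) (λ c+1≤c _ → ℕP.1+n≰n c+1≤c)))
           (cong (at σ (suc c) (suc d) *_) (upSum-target σ (suc c) (suc d) (suc f)))) ⟩
    at σ c d * upSum σ c d (suc f) (suc c) (suc d) + at σ (suc c) (suc d) * upSum σ (suc c) (suc d) (suc f) (suc c) (suc d) ∎
    where open ≡-Reasoning
  upSum-rec σ (suc f) a b c d c<d ≢ rk≤ | no ≢₁ | no ≢₂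
    rewrite upSum-≢ σ (suc c) d (suc f) a b ≢ | upSum-≢ σ c d (suc f) a b ≢₁ | upSum-≢ σ (suc c) (suc d) (suc f) a b ≢₂
    with suc a ≤? b
  ... | no _ = sym (trans (cong₂ _+_ (zeroʳ _) (zeroʳ _)) (+-identityˡ 0#))
  ... | yes a<b = begin
    w * (upSum σ (suc c) d f (suc a) b + upSum σ (suc c) d f a (pred b))
      ≡⟨ cong (w *_) (cong₂ _+_ (upSum-rec σ f (suc a) b c d c<d ≢L (rank-shrinkL a b f rk≤))
                                (upSum-rec σ f a (pred b) c d c<d ≢R (rank-shrinkR a b f rk≤))) ⟩
    w * ((x * upSum σ c d f (suc a) b + y * upSum σ (suc c) (suc d) f (suc a) b)
        + (x * upSum σ c d f a (pred b) + y * upSum σ (suc c) (suc d) f a (pred b)))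
      ≡⟨ solve 7 (λ w x y u₁ u₂ v₁ v₂ → w :* ((x :* u₁ :+ y :* v₁) :+ (x :* u₂ :+ y :* v₂))
                                        := x :* (w :* (u₁ :+ u₂)) :+ y :* (w :* (v₁ :+ v₂))) refl w x y _ _ _ _ ⟩
    x * (w * (upSum σ c d f (suc a) b + upSum σ c d f a (pred b)))
      + y * (w * (upSum σ (suc c) (suc d) f (suc a) b + upSum σ (suc c) (suc d) f a (pred b))) ∎
    where
    open ≡-Reasoning
    w x y : Carrier
    w = at σ a b
    x = at σ c d
    y = at σ (suc c) (suc d)
    ≢L : ¬ (suc c ≡ suc a × d ≡ b)
    ≢L (e₁ , e₂) = ≢₁ (ℕP.suc-injective e₁ , e₂)
    ≢R : ¬ (suc c ≡ a × d ≡ pred b)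
    ≢R (e₁ , e₂) = ≢₂ (e₁ , trans (cong suc e₂) (ℕP.suc-pred b {{ℕ.>-nonZero (ℕP.≤-trans (s≤s z≤n) a<b)}}))

  at-cong : ∀ σ τ (P : ℕ → ℕ → Set) → (∀ I → P (lo I) (hi I) → σ I ≡ τ I) →
            ∀ a b → P a b → at σ a b ≡ at τ a b
  at-cong σ τ P σ≡τ a b Pab with 1 ≤? a | a ≤? b | b ≤? n
  ... | yes p | yes q | yes r = σ≡τ (interval a b p q r) Pab
  ... | no _  | _     | _     = refl
  ... | yes _ | no _  | _     = refl
  ... | yes _ | yes _ | no _  = refl

  downSum-cong : ∀ σ τ f a b → (∀ x y → a ℕ.≤ x → y ℕ.≤ b → at σ x y ≡ at τ x y) →
                 downSum σ f a b ≡ downSum τ f a b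
  downSum-cong σ τ zero    a b σ≡τ = σ≡τ a b ℕP.≤-refl ℕP.≤-refl
  downSum-cong σ τ (suc f) a b σ≡τ with suc a ≤? b
  ... | yes _ = cong₂ _*_ (σ≡τ a b ℕP.≤-refl ℕP.≤-refl) (cong₂ _+_
                  (downSum-cong σ τ f (suc a) b (λ x y a<x y≤b → σ≡τ x y (ℕP.<⇒≤ a<x) y≤b))
                  (downSum-cong σ τ f a (pred b) (λ x y a≤x y<b → σ≡τ x y a≤x (ℕP.≤-trans y<b ℕP.pred[n]≤n))))
  ... | no _  = σ≡τ a b ℕP.≤-refl ℕP.≤-refl

  upSum-cong : ∀ σ τ c d f a b → (∀ x y → x ℕ.≤ c → d ℕ.≤ y → ¬ (c ≡ x × d ≡ y) → at σ x y ≡ at τ x y) →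
               upSum σ c d f a b ≡ upSum τ c d f a b
  upSum-cong σ τ c d f a b σ≡τ with (c ℕ.≟ a) ×-dec (d ℕ.≟ b)
  ... | yes (refl , refl) = trans (upSum-target σ c d f) (sym (upSum-target τ c d f))
  ... | no ≢ with a ℕ.≤? c | d ℕ.≤? b
  ...   | no a≰c | _     = trans (upSum-outside σ c d f a b (λ a≤c _ → a≰c a≤c))
                                  (sym (upSum-outside τ c d f a b (λ a≤c _ → a≰c a≤c)))
  ...   | yes _  | no d≰b = trans (upSum-outside σ c d f a b (λ _ → d≰b)) (sym (upSum-outside τ c d f a b (λ _ → d≰b)))
  ...   | yes a≤c | yes d≤b = trans (upSum-≢ σ c d f a b ≢) (trans (go f) (sym (upSum-≢ τ c d f a b ≢)))
    where
    go : ∀ f → upSumUnless σ c d f a b false ≡ upSumUnless τ c d f a b false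
    go zero = refl
    go (suc f) with suc a ≤? b
    ... | no _  = refl
    ... | yes _ = cong₂ _*_ (σ≡τ a b a≤c d≤b ≢)
                    (cong₂ _+_ (upSum-cong σ τ c d f (suc a) b σ≡τ) (upSum-cong σ τ c d f a (pred b) σ≡τ))

  downSumBelow : Labelling n → ℕ → ℕ → ℕ → Carrier
  downSumBelow σ zero    a b = 1#
  downSumBelow σ (suc f) a b with suc a ≤? b
  ... | yes _ = downSum σ f (suc a) b + downSum σ f a (pred b)
  ... | no _  = 1#

  downSum-split : ∀ σ f a b → downSum σ f a b ≡ at σ a b * downSumBelow σ f a b
  downSum-split σ zero    a b = sym (*-identityʳ _)
  downSum-split σ (suc f) a b with suc a ≤? b
  ... | yes _ = refl
  ... | no _  = sym (*-identityʳ _)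

  downSumBelow-cong : ∀ σ τ f a b → (∀ x y → a ℕ.≤ x → y ℕ.≤ b → ¬ (a ≡ x × b ≡ y) → at σ x y ≡ at τ x y) →
                      downSumBelow σ f a b ≡ downSumBelow τ f a b
  downSumBelow-cong σ τ zero    a b σ≡τ = refl
  downSumBelow-cong σ τ (suc f) a b σ≡τ with suc a ≤? b
  ... | no _    = refl
  ... | yes a<b = cong₂ _+_
    (downSum-cong σ τ f (suc a) b (λ x y a<x y≤b → σ≡τ x y (ℕP.<⇒≤ a<x) y≤b (λ (a≡x , _) → ℕP.<-irrefl a≡x a<x)))
    (downSum-cong σ τ f a (pred b) (λ x y a≤x y<b → σ≡τ x y a≤x (ℕP.≤-trans y<b ℕP.pred[n]≤n)
       (λ (_ , b≡y) → n≰pred[n] (ℕP.≤-trans (s≤s z≤n) a<b) (subst (ℕ._≤ pred b) (sym b≡y) y<b))))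

  PositiveWithin : Labelling n → ℕ → ℕ → Set
  PositiveWithin σ a b = ∀ J → a ℕ.≤ lo J → hi J ℕ.≤ b → 0# < σ J

  at-pos : ∀ σ a b → 1 ℕ.≤ a → a ℕ.≤ b → b ℕ.≤ n → PositiveWithin σ a b → 0# < at σ a b
  at-pos σ a b p q r σ>0 = subst (0# <_) (sym (at-interval σ a b p q r)) (σ>0 _ ℕP.≤-refl ℕP.≤-refl)

  private
    a≤pred[b] : ∀ {a b} → suc a ℕ.≤ b → a ℕ.≤ pred b
    a≤pred[b] {b = suc b} (s≤s a≤b) = a≤b

  downSum-pos : ∀ σ f a b → 1 ℕ.≤ a → a ℕ.≤ b → b ℕ.≤ n → PositiveWithin σ a b → 0# < downSum σ f a b
  downSum-pos σ zero    a b p q r σ>0 = at-pos σ a b p q r σ>0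
  downSum-pos σ (suc f) a b p q r σ>0 with suc a ≤? b
  ... | no _    = at-pos σ a b p q r σ>0
  ... | yes a<b = *-pos (at-pos σ a b p q r σ>0) (+-pos
    (downSum-pos σ f (suc a) b (s≤s z≤n) a<b r (λ J a<lo hi≤b → σ>0 J (ℕP.<⇒≤ a<lo) hi≤b))
    (downSum-pos σ f a (pred b) p (a≤pred[b] a<b) (ℕP.≤-trans ℕP.pred[n]≤n r)
       (λ J a≤lo hi<b → σ>0 J a≤lo (ℕP.≤-trans hi<b ℕP.pred[n]≤n))))

  downSumBelow-pos : ∀ σ f a b → 1 ℕ.≤ a → a ℕ.≤ b → b ℕ.≤ n →
                     (∀ J → a ℕ.≤ lo J → hi J ℕ.≤ b → ¬ (a ≡ lo J × b ≡ hi J) → 0# < σ J) →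
                     0# < downSumBelow σ f a b
  downSumBelow-pos σ zero    a b p q r σ>0 = 0<1
  downSumBelow-pos σ (suc f) a b p q r σ>0 with suc a ≤? b
  ... | no _    = 0<1
  ... | yes a<b = +-pos
    (downSum-pos σ f (suc a) b (s≤s z≤n) a<b r
       (λ J a<lo hi≤b → σ>0 J (ℕP.<⇒≤ a<lo) hi≤b (λ (a≡lo , _) → ℕP.<-irrefl a≡lo a<lo)))
    (downSum-pos σ f a (pred b) p (a≤pred[b] a<b) (ℕP.≤-trans ℕP.pred[n]≤n r)
       (λ J a≤lo hi<b → σ>0 J a≤lo (ℕP.≤-trans hi<b ℕP.pred[n]≤n)
          (λ (_ , b≡hi) → n≰pred[n] (ℕP.≤-trans (s≤s z≤n) a<b) (subst (ℕ._≤ pred b) (sym b≡hi) hi<b))))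

  at-≥0 : ∀ σ → Positive σ → ∀ a b → 0# ≤ at σ a b
  at-≥0 σ σ>0 a b with 1 ≤? a | a ≤? b | b ≤? n
  ... | yes _ | yes _ | yes _ = inj₁ (σ>0 _)
  ... | no _  | _     | _     = inj₂ refl
  ... | yes _ | no _  | _     = inj₂ refl
  ... | yes _ | yes _ | no _  = inj₂ refl

  upSum-≥0 : ∀ σ → Positive σ → ∀ c d f a b → 0# ≤ upSum σ c d f a b
  upSum-≥0 σ σ>0 c d f a b with (c ℕ.≟ a) ×-dec (d ℕ.≟ b)
  ... | yes (refl , refl) = subst (0# ≤_) (sym (upSum-target σ c d f)) (inj₁ 0<1)
  ... | no ≢ = subst (0# ≤_) (sym (upSum-≢ σ c d f a b ≢)) (go f)
    where
    go : ∀ f → 0# ≤ upSumUnless σ c d f a b false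
    go zero = inj₂ refl
    go (suc f) with suc a ≤? b
    ... | no _  = inj₂ refl
    ... | yes _ = *-≥0 (at-≥0 σ σ>0 a b) (+-≥0 (upSum-≥0 σ σ>0 c d f (suc a) b) (upSum-≥0 σ σ>0 c d f a (pred b)))

  upSum-pos : ∀ σ → Positive σ → ∀ c d f a b →
              1 ℕ.≤ a → a ℕ.≤ c → c ℕ.≤ d → d ℕ.≤ b → b ℕ.≤ n → b ∸ a ℕ.≤ f → 0# < upSum σ c d f a b
  upSum-pos σ σ>0 c d f a b 1≤a a≤c c≤d d≤b b≤n rk≤f with (c ℕ.≟ a) ×-dec (d ℕ.≟ b)
  ... | yes (refl , refl) = subst (0# <_) (sym (upSum-target σ c d f)) 0<1
  ... | no ≢ = subst (0# <_) (sym (upSum-≢ σ c d f a b ≢)) (go f rk≤f)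
    where
    a<b : a ℕ.< b
    a<b = ℕP.m∸n≢0⇒n<m (λ b-a≡0 → ℕP.n≮0 (subst (d ∸ c ℕ.<_) b-a≡0 (nested-rank-< a≤c d≤b c≤d ≢)))
    go : ∀ f → b ∸ a ℕ.≤ f → 0# < upSumUnless σ c d f a b false
    go zero rk≤0 = ⊥-elim (ℕP.<⇒≱ a<b (rank≡0⇒≤ rk≤0))
    go (suc f) rk≤ with suc a ≤? b
    ... | no a≮b = ⊥-elim (a≮b a<b)
    ... | yes _ with a ℕ.<? c
    ...   | yes a<c = *-pos (at-pos σ a b 1≤a (ℕP.<⇒≤ a<b) b≤n (λ J _ _ → σ>0 J))
                        (+-pos-≥0 (upSum-pos σ σ>0 c d f (suc a) b (s≤s z≤n) a<c c≤d d≤b b≤n (rank-shrinkL a b f rk≤))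
                                  (upSum-≥0 σ σ>0 c d f a (pred b)))
    ...   | no a≮c with ℕP.≤-antisym a≤c (ℕP.≮⇒≥ a≮c)
    ...     | refl = *-pos (at-pos σ a b 1≤a (ℕP.<⇒≤ a<b) b≤n (λ J _ _ → σ>0 J))
                       (+-≥0-pos (upSum-≥0 σ σ>0 c d f (suc a) b)
                                 (upSum-pos σ σ>0 c d f a (pred b) 1≤a a≤c c≤d d≤pred[b]
                                            (ℕP.≤-trans ℕP.pred[n]≤n b≤n) (rank-shrinkR a b f rk≤)))
      where
      d≤pred[b] : d ℕ.≤ pred b
      d≤pred[b] = a≤pred[b] (ℕP.≤∧≢⇒< d≤b (λ d≡b → ≢ (refl , d≡b)))

  downWeight-rec : ∀ σ a b → a ℕ.< b →
                   downWeight σ a (suc b) ≡ at σ a (suc b) * (downWeight σ (suc a) (suc b) + downWeight σ a b)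
  downWeight-rec σ a b a<b rewrite ℕP.+-∸-assoc 1 (ℕP.<⇒≤ a<b) with suc a ≤? suc b
  ... | yes _   = refl
  ... | no a≮b = ⊥-elim (a≮b (ℕP.<⇒≤ (s≤s a<b)))

  downWeight-singleton : ∀ σ a → downWeight σ a a ≡ at σ a a
  downWeight-singleton σ a rewrite ℕP.n∸n≡0 a = refl

  at-beyond : ∀ σ a → at σ a (suc n) ≡ 0#
  at-beyond σ a with 1 ≤? a | a ≤? suc n | suc n ≤? n
  ... | yes _ | yes _ | yes n+1≤n = ⊥-elim (ℕP.1+n≰n n+1≤n)
  ... | no _  | _     | _         = refl
  ... | yes _ | no _  | _         = refl
  ... | yes _ | yes _ | no _      = refl

  at-≈ : ∀ {σ τ} → σ ≈L τ → ∀ a b → at σ a b ≡ at τ a b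
  at-≈ {σ} {τ} σ≈τ a b = at-cong σ τ (λ _ _ → ⊤) (λ J _ → σ≈τ J) a b _

module IntervalProducts (F : CompleteOrderedField) {n : ℕ} where
  open CompleteOrderedField F
  open Rowmotion F
  open FieldProperties F
  open RangeProduct F
  open ChainSums F {n}

  Π'-++ : ∀ xs ys → Π' (xs ++ ys) ≡ Π' xs * Π' ys
  Π'-++ []       ys = sym (*-identityˡ _)
  Π'-++ (x ∷ xs) ys = trans (cong (x *_) (Π'-++ xs ys)) (sym (*-assoc x _ _))

  Π'-concat : ∀ {A : Set} (w : A → Carrier) xss → Π' (map w (concat xss)) ≡ Π' (map (Π' ∘ map w) xss)
  Π'-concat w []         = refl
  Π'-concat w (xs ∷ xss) = trans (cong Π' (List.map-++ w xs (concat xss)))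
    (trans (Π'-++ (map w xs) _) (cong (Π' (map w xs) *_) (Π'-concat w xss)))

  Π'-mapMaybe : ∀ {A B : Set} (w : B → Carrier) (f : A → Maybe B) xs →
                Π' (map w (mapMaybe f xs)) ≡ Π' (map (maybe w 1# ∘ f) xs)
  Π'-mapMaybe w f []       = refl
  Π'-mapMaybe w f (x ∷ xs) with f x
  ... | just y  = cong (w y *_) (Π'-mapMaybe w f xs)
  ... | nothing = trans (Π'-mapMaybe w f xs) (sym (*-identityˡ _))

  Π'-applyUpTo : ∀ {A : Set} (w : A → Carrier) (f : ℕ → A) k → Π' (map w (applyUpTo f k)) ≡ prod (w ∘ f) 0 k
  Π'-applyUpTo w f zero    = refl
  Π'-applyUpTo w f (suc k) = cong (w (f 0) *_) (trans (Π'-applyUpTo w (f ∘ suc) k) (sym (prod-shift (w ∘ f) 0 k)))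

  Π'-filter : ∀ {A : Set} (w : A → Carrier) P xs → Π' (map w (filterᵇ P xs)) ≡ Π' (map (λ x → if P x then w x else 1#) xs)
  Π'-filter w P []       = refl
  Π'-filter w P (x ∷ xs) with P x
  ... | true  = cong (w x *_) (Π'-filter w P xs)
  ... | false = trans (Π'-filter w P xs) (sym (*-identityˡ _))

  weightAt : (Interval n → Bool) → Labelling n → ℕ → ℕ → Carrier
  weightAt P σ a b = maybe (λ J → if P J then σ J else 1#) 1# (mkInterval? n a b)

  Π'-filter-allIntervals : ∀ σ P → Π' (map σ (filterᵇ P (allIntervals n))) ≡ prod (λ a → prod (weightAt P σ (suc a) ∘ suc) 0 n) 0 n
  Π'-filter-allIntervals σ P = begin
    Π' (map σ (filterᵇ P (allIntervals n)))
      ≡⟨ Π'-filter σ P (allIntervals n) ⟩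
    Π' (map w (concat (map row (upTo n))))
      ≡⟨ Π'-concat w (map row (upTo n)) ⟩
    Π' (map (Π' ∘ map w) (map row (upTo n)))
      ≡⟨ cong Π' (sym (List.map-∘ (upTo n))) ⟩
    Π' (map (Π' ∘ map w ∘ row) (upTo n))
      ≡⟨ Π'-applyUpTo (Π' ∘ map w ∘ row) (λ a → a) n ⟩
    prod (Π' ∘ map w ∘ row) 0 n
      ≡⟨ prod-cong 0 n (λ a _ → trans (Π'-mapMaybe w (mkInterval? n (suc a)) (applyUpTo suc n))
                                         (Π'-applyUpTo _ suc n)) ⟩
    prod (λ a → prod (weightAt P σ (suc a) ∘ suc) 0 n) 0 n ∎
    where
    open ≡-Reasoning
    w : Interval n → Carrier
    w J = if P J then σ J else 1#
    row : ℕ → List (Interval n)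
    row a = mapMaybe (mkInterval? n (suc a)) (applyUpTo suc n)

  weightAt-interval : ∀ P σ a b p q r → weightAt P σ a b ≡ (if P (interval a b p q r) then σ (interval a b p q r) else 1#)
  weightAt-interval P σ a b p q r rewrite mkInterval?-complete {n} a b p q r = refl

  weightAt-rejected : ∀ P σ a b → (∀ p q r → P (interval a b p q r) ≡ false) → weightAt P σ a b ≡ 1#
  weightAt-rejected P σ a b rejected with 1 ≤? a | a ≤? b | b ≤? n
  ... | yes p | yes q | yes r rewrite rejected p q r = refl
  ... | no _  | _     | _     = refl
  ... | yes _ | no _  | _     = refl
  ... | yes _ | yes _ | no _  = refl

  weightAt-accepted : ∀ P σ a b p q r → P (interval a b p q r) ≡ true → weightAt P σ a b ≡ at σ a b
  weightAt-accepted P σ a b p q r accepted = trans (weightAt-interval P σ a b p q r)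
    (trans (cong (λ t → if t then σ _ else 1#) accepted) (sym (at-interval σ a b p q r)))

module Hook (F : CompleteOrderedField) (m i′ j : ℕ) (m≡i′+j : m ≡ i′ ℕ.+ j) where
  open CompleteOrderedField F
  open Rowmotion F
  open FieldProperties F
  open RangeProduct F
  open ChainSums F {suc m}
  open IntervalProducts F {suc m}

  N i : ℕ
  N = suc m
  i = suc i′

  N≡i+j : N ≡ i ℕ.+ j
  N≡i+j = cong suc m≡i′+j

  rowProd colProd innerProd rectangle : Labelling N → Carrier
  rowProd σ   = prod (at σ i) i (suc j)
  colProd σ   = prod (λ a → at σ a i) 1 i
  innerProd σ = prod (λ b → prod (λ a → at σ a b) 1 i′) (suc i) j
  rectangle σ = prod (λ b → prod (λ a → at σ a b) 1 i) i (suc j)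

  rectangle-via-hook : ∀ σ → rectangle σ * at σ i i ≡ rowProd σ * colProd σ * innerProd σ
  rectangle-via-hook σ = begin
    colProd σ * prod (λ b → prod (λ a → at σ a b) 1 i) (suc i) j * at σ i i
      ≡⟨ cong (λ t → colProd σ * t * at σ i i) (trans (prod-cong (suc i) j (λ b _ → prod-snoc (λ a → at σ a b) 1 i′))
                                                      (prod-* _ (at σ i) (suc i) j)) ⟩
    colProd σ * (innerProd σ * prod (at σ i) (suc i) j) * at σ i i
      ≡⟨ solve 4 (λ c q p x → c :* (q :* p) :* x := x :* p :* c :* q) refl (colProd σ) (innerProd σ) _ (at σ i i) ⟩
    rowProd σ * colProd σ * innerProd σ ∎
    where open ≡-Reasoning

  private
    ≢⇒≡ᵇ-false : ∀ x y → x ≢ y → (x ≡ᵇ y) ≡ false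
    ≢⇒≡ᵇ-false x y x≢y with x ≡ᵇ y in e
    ... | false = refl
    ... | true  = ⊥-elim (x≢y (ℕP.≡ᵇ⇒≡ x y (subst T (sym e) _)))

    loIs hiIs : Interval N → Bool
    loIs p = lo p ≡ᵇ i
    hiIs p = hi p ≡ᵇ i

    ≢i′ : ∀ {k} → k ≢ i′ → suc k ≢ i
    ≢i′ k≢i′ k+1≡i = k≢i′ (ℕP.suc-injective k+1≡i)

    N≡i′+suc-j : N ≡ i′ ℕ.+ suc j
    N≡i′+suc-j = trans (cong suc m≡i′+j) (sym (ℕP.+-suc i′ j))

    prod-only-at-i′ : ∀ (f : ℕ → Carrier) → (∀ k → k ≢ i′ → f k ≡ 1#) → prod f 0 N ≡ f i′
    prod-only-at-i′ f elsewhere = trans (cong (prod f 0) N≡i′+suc-j)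
      (prod-single f i′ j (λ k k<i′ → elsewhere k (ℕP.<⇒≢ k<i′)) (λ k i′<k → elsewhere k (ℕP.<⇒≢ i′<k ∘ sym)))

  h-row : ∀ σ → Π' (map σ (filterᵇ loIs (allIntervals N))) ≡ rowProd σ
  h-row σ = begin
    Π' (map σ (filterᵇ loIs (allIntervals N)))
      ≡⟨ Π'-filter-allIntervals σ loIs ⟩
    prod (λ a → prod (weightAt loIs σ (suc a) ∘ suc) 0 N) 0 N
      ≡⟨ prod-only-at-i′ _ (λ a a≢i′ → prod-≡1 0 N (λ b _ →
           weightAt-rejected loIs σ (suc a) (suc b) (λ _ _ _ → ≢⇒≡ᵇ-false _ i (≢i′ a≢i′)))) ⟩
    prod (weightAt loIs σ i ∘ suc) 0 N
      ≡⟨ cong (prod (weightAt loIs σ i ∘ suc) 0) N≡i′+suc-j ⟩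
    prod (weightAt loIs σ i ∘ suc) 0 (i′ ℕ.+ suc j)
      ≡⟨ prod-+ _ 0 i′ (suc j) ⟩
    prod (weightAt loIs σ i ∘ suc) 0 i′ * prod (weightAt loIs σ i ∘ suc) i′ (suc j)
      ≡⟨ cong₂ _*_ (prod-≡1 0 i′ (λ b (_ , b<i′) → weightAt-rejected loIs σ i (suc b) (λ _ i≤b+1 _ → ⊥-elim (ℕP.<⇒≱ (s≤s b<i′) i≤b+1))))
                   (prod-cong i′ (suc j) (λ b (i′≤b , b<) → weightAt-accepted loIs σ i (suc b) (s≤s z≤n) (s≤s i′≤b)
                                                              (subst (suc b ℕ.≤_) (sym N≡i′+suc-j) b<) (≡ᵇ-refl i))) ⟩
    1# * prod (at σ i ∘ suc) i′ (suc j)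
      ≡⟨ trans (*-identityˡ _) (sym (prod-shift (at σ i) i′ (suc j))) ⟩
    rowProd σ ∎
    where open ≡-Reasoning

  h-column : ∀ σ → Π' (map σ (filterᵇ hiIs (allIntervals N))) ≡ colProd σ
  h-column σ = begin
    Π' (map σ (filterᵇ hiIs (allIntervals N)))
      ≡⟨ Π'-filter-allIntervals σ hiIs ⟩
    prod (λ a → prod (weightAt hiIs σ (suc a) ∘ suc) 0 N) 0 N
      ≡⟨ prod-cong 0 N (λ a _ → prod-only-at-i′ _ (λ b b≢i′ →
           weightAt-rejected hiIs σ (suc a) (suc b) (λ _ _ _ → ≢⇒≡ᵇ-false _ i (≢i′ b≢i′)))) ⟩
    prod (λ a → weightAt hiIs σ (suc a) i) 0 N
      ≡⟨ cong (prod _ 0) N≡i+j ⟩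
    prod (λ a → weightAt hiIs σ (suc a) i) 0 (i ℕ.+ j)
      ≡⟨ prod-+ _ 0 i j ⟩
    prod (λ a → weightAt hiIs σ (suc a) i) 0 i * prod (λ a → weightAt hiIs σ (suc a) i) i j
      ≡⟨ cong₂ _*_ (prod-cong 0 i (λ a (_ , a<i) → weightAt-accepted hiIs σ (suc a) i (s≤s z≤n) a<i i≤N (≡ᵇ-refl i)))
                   (prod-≡1 i j (λ a (i≤a , _) → weightAt-rejected hiIs σ (suc a) i (λ _ a+1≤i _ → ⊥-elim (ℕP.<⇒≱ (s≤s i≤a) a+1≤i)))) ⟩
    prod (λ a → at σ (suc a) i) 0 i * 1#
      ≡⟨ trans (*-identityʳ _) (sym (prod-shift (λ a → at σ a i) 0 i)) ⟩
    colProd σ ∎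
    where
    open ≡-Reasoning
    i≤N : i ℕ.≤ N
    i≤N = subst (i ℕ.≤_) (sym N≡i+j) (ℕP.m≤m+n i j)

  statistic-hook : ∀ κ σ → h m κ i σ ≡ rowProd σ * colProd σ
  statistic-hook κ σ = cong₂ _*_ (h-row σ) (h-column σ)

  innerProd-pos : ∀ σ → Positive σ → 0# < innerProd σ
  innerProd-pos σ σ>0 = prod-pos (suc i) j (λ b (i<b , b<) → prod-pos 1 i′ (λ a (1≤a , a<i) →
    at-pos σ a b 1≤a (ℕP.≤-trans (ℕP.<⇒≤ a<i) (ℕP.<⇒≤ i<b)) (subst (b ℕ.≤_) (sym N≡i+j) (ℕP.≤-pred b<))
           (λ J _ _ → σ>0 J)))

  innerProd-≈ : ∀ {σ τ} → σ ≈L τ → innerProd σ ≡ innerProd τ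
  innerProd-≈ σ≈τ = prod-cong (suc i) j (λ b _ → prod-cong 1 i′ (λ a _ → at-≈ σ≈τ a b))

module Toggles (F : CompleteOrderedField) (m : ℕ) (κ : CompleteOrderedField.Carrier F) where
  open CompleteOrderedField F
  open Rowmotion F
  open FieldProperties F
  open ChainSums F {suc m}
  open RangeProduct F

  N : ℕ
  N = suc m

  toggleValue : Labelling N → Interval N → Carrier
  toggleValue σ p = κ / throughSum σ p N (top m)

  upFromTop : Labelling N → ℕ → ℕ → Carrier
  upFromTop σ c d = upSum σ c d N 1 N

  upWeight : Labelling N → ℕ → ℕ → Carrier
  upWeight σ c d = at σ c d * upFromTop σ c d

  downBelow : Labelling N → Interval N → Carrier
  downBelow σ q = downSumBelow σ (rk q) (lo q) (hi q)

  throughSum-cong : ∀ σ τ x → (∀ J → Nested J x → σ J ≡ τ J) → throughSum σ x N (top m) ≡ throughSum τ x N (top m)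
  throughSum-cong σ τ x σ≡τ = begin
    throughSum σ x N (top m)
      ≡⟨ throughSum-split σ x N (top m) (ℕP.n≤1+n m) ⟩
    upFromTop σ (lo x) (hi x) * downWeight σ (lo x) (hi x)
      ≡⟨ cong₂ _*_ (upSum-cong σ τ (lo x) (hi x) N 1 N (λ a b a≤ ≤b _ → at-cong σ τ (λ a b → a ℕ.≤ lo x × hi x ℕ.≤ b)
                                                                   (λ J → σ≡τ J ∘ inj₁) a b (a≤ , ≤b)))
                   (downSum-cong σ τ (rk x) (lo x) (hi x) (λ a b ≤a b≤ → at-cong σ τ (λ a b → lo x ℕ.≤ a × b ℕ.≤ hi x)
                                                                   (λ J → σ≡τ J ∘ inj₂) a b (≤a , b≤))) ⟩
    upFromTop τ (lo x) (hi x) * downWeight τ (lo x) (hi x)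
      ≡⟨ sym (throughSum-split τ x N (top m) (ℕP.n≤1+n m)) ⟩
    throughSum τ x N (top m) ∎
    where open ≡-Reasoning

  toggles-∉ : ∀ σ L q → q ∉ L → foldr (toggle m κ) σ L q ≡ σ q
  toggles-∉ σ []      q _   = refl
  toggles-∉ σ (x ∷ L) q q∉ with sameI x q in x≟q
  ... | true  = ⊥-elim (q∉ (here (sym (sameI⇒≡ {I = x} x≟q))))
  ... | false = toggles-∉ σ L q (q∉ ∘ there)

  -- Toggles at one rank commute: no two elements of the same rank are nested, and the toggle at p
  -- only reads elements nested with p.
  toggles-∈ : ∀ σ k L q → (∀ J → J ∈ L → rk J ≡ k) → Unique L → q ∈ L → foldr (toggle m κ) σ L q ≡ toggleValue σ q
  toggles-∈ σ k (x ∷ L) q rk≡k (x∉L ∷ uL) (here refl) rewrite sameI-refl x =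
    cong (κ /_) (throughSum-cong _ σ x (λ J J≍x → toggles-∉ σ L J (λ J∈L →
      All.lookup x∉L J∈L (sym (nested-same-rank⇒≡ J x J≍x (trans (rk≡k J (there J∈L)) (sym (rk≡k x (here refl)))))))))
  toggles-∈ σ k (x ∷ L) q rk≡k (x∉L ∷ uL) (there q∈L) with sameI x q in x≟q
  ... | true  = ⊥-elim (All.lookup x∉L q∈L (sameI⇒≡ {I = x} x≟q))
  ... | false = toggles-∈ σ k L q (λ J → rk≡k J ∘ there) uL q∈L

  private
    ofRank : ℕ → Interval N → Bool
    ofRank k p = rk p ≡ᵇ k

  rankToggle-rank : ∀ σ k q → rk q ≡ k → rankToggle m κ k σ q ≡ toggleValue σ q
  rankToggle-rank σ k q rk≡k = toggles-∈ σ k (filterᵇ (ofRank k) (allIntervals N)) q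
    (λ J J∈ → ℕP.≡ᵇ⇒≡ (rk J) k (proj₂ (∈-filter⁻ (T? ∘ ofRank k) {xs = allIntervals N} J∈)))
    (Unique.filter⁺ (T? ∘ ofRank k) allIntervals-unique)
    (∈-filter⁺ (T? ∘ ofRank k) (∈-allIntervals q) (ℕP.≡⇒≡ᵇ (rk q) k rk≡k))

  rankToggle-otherRank : ∀ σ k q → rk q ≢ k → rankToggle m κ k σ q ≡ σ q
  rankToggle-otherRank σ k q rk≢k = toggles-∉ σ (filterᵇ (ofRank k) (allIntervals N)) q
    (λ q∈ → rk≢k (ℕP.≡ᵇ⇒≡ (rk q) k (proj₂ (∈-filter⁻ (T? ∘ ofRank k) {xs = allIntervals N} q∈))))

  partialRowmotion : ℕ → Labelling N → Labelling N
  partialRowmotion r π = foldl (λ σ k → rankToggle m κ k σ) π (upTo r)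

  partialRowmotion-suc : ∀ r π → partialRowmotion (suc r) π ≡ rankToggle m κ r (partialRowmotion r π)
  partialRowmotion-suc r π = trans (cong (foldl (λ σ k → rankToggle m κ k σ) π) (sym (List.upTo-∷ʳ r)))
                                   (List.foldl-∷ʳ (λ σ k → rankToggle m κ k σ) π r (upTo r))

  partialRowmotion-untouched : ∀ π r q → r ℕ.≤ rk q → partialRowmotion r π q ≡ π q
  partialRowmotion-untouched π zero    q _     = refl
  partialRowmotion-untouched π (suc r) q r<rk = trans (cong (λ σ → σ q) (partialRowmotion-suc r π))
    (trans (rankToggle-otherRank (partialRowmotion r π) r q (λ rk≡r → ℕP.<-irrefl (sym rk≡r) r<rk))
           (partialRowmotion-untouched π r q (ℕP.<⇒≤ r<rk)))

  partialRowmotion-settled : ∀ π r q → rk q ℕ.< r → partialRowmotion r π q ≡ partialRowmotion (suc (rk q)) π q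
  partialRowmotion-settled π (suc r) q rk<r+1 with rk q ℕ.≟ r
  ... | yes refl = refl
  ... | no rk≢r  = trans (cong (λ σ → σ q) (partialRowmotion-suc r π))
    (trans (rankToggle-otherRank (partialRowmotion r π) r q rk≢r)
           (partialRowmotion-settled π r q (ℕP.≤∧≢⇒< (ℕP.≤-pred rk<r+1) rk≢r)))

  rowmotion-at : ∀ π q → rowmotion m κ π q ≡ toggleValue (partialRowmotion (rk q) π) q
  rowmotion-at π q = trans (partialRowmotion-settled π N q (rk<n q))
    (trans (cong (λ σ → σ q) (partialRowmotion-suc (rk q) π)) (rankToggle-rank (partialRowmotion (rk q) π) (rk q) q refl))

  partialRowmotion-below : ∀ π (q J : Interval N) → rk J ℕ.< rk q → partialRowmotion (rk q) π J ≡ rowmotion m κ π J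
  partialRowmotion-below π q J rk< = trans (partialRowmotion-settled π (rk q) J rk<) (sym (partialRowmotion-settled π N J (rk<n J)))

  -- When q is toggled, the elements above q still carry π and those below already carry ρ(π).
  rowmotion-value : ∀ π q → rowmotion m κ π q ≡ κ / (upFromTop π (lo q) (hi q) * (π q * downBelow (rowmotion m κ π) q))
  rowmotion-value π q = trans (rowmotion-at π q) (cong (κ /_) (begin
    throughSum σ q N (top m)
      ≡⟨ throughSum-split σ q N (top m) (ℕP.n≤1+n m) ⟩
    upFromTop σ (lo q) (hi q) * downWeight σ (lo q) (hi q)
      ≡⟨ cong (upFromTop σ (lo q) (hi q) *_) (downSum-split σ (rk q) (lo q) (hi q)) ⟩
    upFromTop σ (lo q) (hi q) * (at σ (lo q) (hi q) * downBelow σ q)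
      ≡⟨ cong₂ (λ u v → u * (v * downBelow σ q)) up-untouched (at-lo-hi σ q) ⟩
    upFromTop π (lo q) (hi q) * (σ q * downBelow σ q)
      ≡⟨ cong₂ (λ u v → upFromTop π (lo q) (hi q) * (u * v))
           (partialRowmotion-untouched π (rk q) q ℕP.≤-refl) down-settled ⟩
    upFromTop π (lo q) (hi q) * (π q * downBelow (rowmotion m κ π) q) ∎))
    where
    open ≡-Reasoning
    σ : Labelling N
    σ = partialRowmotion (rk q) π
    up-untouched : upFromTop σ (lo q) (hi q) ≡ upFromTop π (lo q) (hi q)
    up-untouched = upSum-cong σ π (lo q) (hi q) N 1 N (λ x y x≤ ≤y ≢ →
      at-cong σ π (λ x y → x ℕ.≤ lo q × hi q ℕ.≤ y × ¬ (lo q ≡ x × hi q ≡ y))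
        (λ J (x≤ , ≤y , ≢) → partialRowmotion-untouched π (rk q) J (ℕP.<⇒≤ (nested-rank-< x≤ ≤y (lo≤hi q) ≢)))
        x y (x≤ , ≤y , ≢))
    down-settled : downBelow σ q ≡ downBelow (rowmotion m κ π) q
    down-settled = downSumBelow-cong σ (rowmotion m κ π) (rk q) (lo q) (hi q) (λ x y ≤x y≤ ≢ →
      at-cong σ (rowmotion m κ π) (λ x y → lo q ℕ.≤ x × y ℕ.≤ hi q × ¬ (lo q ≡ x × hi q ≡ y))
        (λ J (≤x , y≤ , ≢) → partialRowmotion-below π q J (nested-rank-< ≤x y≤ (lo≤hi J) (swap-≢ ≢)))
        x y (≤x , y≤ , ≢))

  upWeight-rec : ∀ π c d → c ℕ.< d → ¬ (suc c ≡ 1 × d ≡ N) →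
                 upWeight π (suc c) d ≡ at π (suc c) d * (upWeight π c d + upWeight π (suc c) (suc d))
  upWeight-rec π c d c<d ≢top = cong (at π (suc c) d *_) (upSum-rec π N 1 N c d c<d ≢top (ℕP.n≤1+n m))

  upWeight-top : ∀ π → upWeight π 1 N ≡ at π 1 N
  upWeight-top π = trans (cong (at π 1 N *_) (upSum-target π 1 N N)) (*-identityʳ _)

  upWeight-pos : ∀ π → Positive π → ∀ a b → 1 ℕ.≤ a → a ℕ.≤ b → b ℕ.≤ N → 0# < upWeight π a b
  upWeight-pos π π>0 a b 1≤a a≤b b≤N = *-pos (at-pos π a b 1≤a a≤b b≤N (λ J _ _ → π>0 J))
    (upSum-pos π π>0 a b N 1 N ℕP.≤-refl 1≤a a≤b b≤N ℕP.≤-refl (ℕP.n≤1+n m))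

  -- The recurrence still applies at the boundary, where `at` returns its junk value 0.
  upWeight-firstRow : ∀ π c b → b ℕ.+ c ≡ N → 1 ℕ.≤ b → upWeight π 1 b ≡ prod (at π 1) b (suc c)
  upWeight-firstRow π zero b b+0≡N _ rewrite trans (sym (ℕP.+-identityʳ b)) b+0≡N = trans (upWeight-top π) (sym (*-identityʳ _))
  upWeight-firstRow π (suc c) b b+c+1≡N 1≤b = begin
    upWeight π 1 b
      ≡⟨ upWeight-rec π 0 b 1≤b (λ (_ , b≡N) → ℕP.<-irrefl b≡N b<N) ⟩
    at π 1 b * (at π 0 b * upFromTop π 0 b + upWeight π 1 (suc b))
      ≡⟨ cong (at π 1 b *_) (trans (cong (_+ upWeight π 1 (suc b)) (zeroˡ _)) (+-identityˡ _)) ⟩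
    at π 1 b * upWeight π 1 (suc b)
      ≡⟨ cong (at π 1 b *_) (upWeight-firstRow π c (suc b) (trans (sym (ℕP.+-suc b c)) b+c+1≡N) (s≤s z≤n)) ⟩
    at π 1 b * prod (at π 1) (suc b) (suc c) ∎
    where
    open ≡-Reasoning
    b<N : b ℕ.< N
    b<N = subst (b ℕ.<_) b+c+1≡N (ℕP.≤-trans (s≤s (ℕP.m≤m+n b c)) (ℕP.≤-reflexive (sym (ℕP.+-suc b c))))

  upWeight-lastColumn : ∀ π a → a ℕ.< N → upWeight π (suc a) N ≡ prod (λ c → at π c N) 1 (suc a)
  upWeight-lastColumn π zero    _   = trans (upWeight-top π) (sym (*-identityʳ _))
  upWeight-lastColumn π (suc a) a<N = begin
    upWeight π (suc (suc a)) N
      ≡⟨ upWeight-rec π (suc a) N a<N (λ (a+2≡1 , _) → ℕP.0≢1+n (sym (ℕP.suc-injective a+2≡1))) ⟩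
    at π (suc (suc a)) N * (upWeight π (suc a) N + at π (suc (suc a)) (suc N) * upFromTop π (suc (suc a)) (suc N))
      ≡⟨ cong (at π (suc (suc a)) N *_) (trans (cong (upWeight π (suc a) N +_) beyond-vanishes) (+-identityʳ _)) ⟩
    at π (suc (suc a)) N * upWeight π (suc a) N
      ≡⟨ cong (at π (suc (suc a)) N *_) (upWeight-lastColumn π a (ℕP.<⇒≤ a<N)) ⟩
    at π (suc (suc a)) N * prod (λ c → at π c N) 1 (suc a)
      ≡⟨ *-comm _ _ ⟩
    prod (λ c → at π c N) 1 (suc a) * at π (suc (suc a)) N
      ≡⟨ sym (prod-snoc _ 1 (suc a)) ⟩
    prod (λ c → at π c N) 1 (suc (suc a)) ∎
    where
    open ≡-Reasoning
    beyond-vanishes : at π (suc (suc a)) (suc N) * upFromTop π (suc (suc a)) (suc N) ≡ 0#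
    beyond-vanishes = trans (cong (_* upFromTop π (suc (suc a)) (suc N)) (at-beyond π (suc (suc a)))) (zeroˡ _)

module RowmotionStep (F : CompleteOrderedField) (m : ℕ) (κ : CompleteOrderedField.Carrier F)
                     (κ>0 : CompleteOrderedField._<_ F (CompleteOrderedField.0# F) κ)
                     (π : Rowmotion.Labelling F (suc m)) (π>0 : Rowmotion.Positive F π) where
  open CompleteOrderedField F
  open Rowmotion F
  open FieldProperties F
  open ChainSums F {suc m}
  open RangeProduct F
  open Toggles F m κ

  ρπ : Labelling N
  ρπ = rowmotion m κ π

  private
    denominator : Interval N → Carrier
    denominator q = upFromTop π (lo q) (hi q) * (π q * downBelow ρπ q)

    pos-below-rank : ∀ r q → rk q ℕ.< r → 0# < ρπ q × 0# < denominator q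
    pos-below-rank (suc r) q rk≤r =
      subst (0# <_) (sym (rowmotion-value π q)) (*-pos κ>0 (⁻¹-pos denominator>0)) , denominator>0
      where
      below>0 : 0# < downBelow ρπ q
      below>0 = downSumBelow-pos ρπ (rk q) (lo q) (hi q) (1≤lo q) (lo≤hi q) (hi≤n q) (λ J ≤lo hi≤ ≢ →
        proj₁ (pos-below-rank r J (ℕP.<-≤-trans (nested-rank-< ≤lo hi≤ (lo≤hi J) (swap-≢ ≢)) (ℕP.≤-pred rk≤r))))
      denominator>0 : 0# < denominator q
      denominator>0 = *-pos (upSum-pos π π>0 (lo q) (hi q) N 1 N ℕP.≤-refl (1≤lo q) (lo≤hi q) (hi≤n q) ℕP.≤-refl (ℕP.n≤1+n m))
                            (*-pos (π>0 q) below>0)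

  rowmotion-pos : Positive ρπ
  rowmotion-pos q = proj₁ (pos-below-rank N q (rk<n q))

  downWeight-upWeight : ∀ a b → 1 ℕ.≤ a → a ℕ.≤ b → b ℕ.≤ N → downWeight ρπ a b * upWeight π a b ≡ κ
  downWeight-upWeight a b 1≤a a≤b b≤N = begin
    downWeight ρπ a b * upWeight π a b
      ≡⟨ cong₂ _*_ (trans (downSum-split ρπ (rk q) a b) (cong (_* downBelow ρπ q) (at-lo-hi ρπ q)))
                   (cong (_* upFromTop π a b) (at-lo-hi π q)) ⟩
    (ρπ q * downBelow ρπ q) * (π q * upFromTop π a b)
      ≡⟨ solve 4 (λ r s p c → (r :* s) :* (p :* c) := r :* (c :* (p :* s))) refl (ρπ q) (downBelow ρπ q) (π q) _ ⟩
    ρπ q * denominator q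
      ≡⟨ cong (_* denominator q) (rowmotion-value π q) ⟩
    κ * denominator q ⁻¹ * denominator q
      ≡⟨ x*y⁻¹*y≡x κ (>0⇒≢0 (proj₂ (pos-below-rank N q (rk<n q)))) ⟩
    κ                                        ∎
    where
    open ≡-Reasoning
    q : Interval N
    q = interval a b 1≤a a≤b b≤N

  downWeight-pos : ∀ a b → 1 ℕ.≤ a → a ℕ.≤ b → b ℕ.≤ N → 0# < downWeight ρπ a b
  downWeight-pos a b 1≤a a≤b b≤N = downSum-pos ρπ (b ∸ a) a b 1≤a a≤b b≤N (λ J _ _ → rowmotion-pos J)

  -- Writing β = κ / α turns this into the recurrence of α at [a,b+1] (`downWeight-rec`).
  upWeight-exchange : ∀ a b → 1 ℕ.≤ a → a ℕ.< b → b ℕ.≤ m →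
                      at ρπ a (suc b) * upWeight π a (suc b) * upWeight π (suc a) b ≡
                      at π (suc a) b * upWeight π (suc a) (suc b) * upWeight π a b
  upWeight-exchange a b 1≤a a<b b≤m = *-cancelʳ (L * R) (>0⇒≢0 (*-pos L>0 R>0)) (begin
    r * x * upWeight π (suc a) b * (L * R)
      ≡⟨ cong (λ t → r * x * t * (L * R)) (upWeight-rec π a b a<b (λ (_ , b≡N) → ℕP.1+n≰n (subst (ℕ._≤ m) b≡N b≤m))) ⟩
    r * x * (s * (y₁ + y₂)) * (L * R)
      ≡⟨ solve 7 (λ r x s y₁ y₂ L R → r :* x :* (s :* (y₁ :+ y₂)) :* (L :* R)
                                     := s :* (x :* (r :* ((y₁ :* R) :* L :+ (y₂ :* L) :* R)))) refl r x s y₁ y₂ L R ⟩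
    s * (x * (r * ((y₁ * R) * L + (y₂ * L) * R)))
      ≡⟨ cong (λ t → s * (x * (r * t))) (cong₂ _+_ (cong (_* L) y₁R≡κ) (cong (_* R) y₂L≡κ)) ⟩
    s * (x * (r * (κ * L + κ * R)))
      ≡⟨ solve 6 (λ s x r k L R → s :* (x :* (r :* (k :* L :+ k :* R))) := s :* k :* ((r :* (L :+ R)) :* x)) refl s x r κ L R ⟩
    s * κ * ((r * (L + R)) * x)
      ≡⟨ cong (λ t → s * κ * (t * x)) (sym (downWeight-rec ρπ a b a<b)) ⟩
    s * κ * (downWeight ρπ a (suc b) * x)
      ≡⟨ cong (s * κ *_) (downWeight-upWeight a (suc b) 1≤a a≤b+1 (s≤s b≤m)) ⟩
    s * κ * κ
      ≡⟨ cong₂ (λ u v → s * u * v) (sym y₂L≡κ) (sym y₁R≡κ) ⟩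
    s * (y₂ * L) * (y₁ * R)
      ≡⟨ solve 5 (λ s y₂ L y₁ R → s :* (y₂ :* L) :* (y₁ :* R) := s :* y₂ :* y₁ :* (L :* R)) refl s y₂ L y₁ R ⟩
    s * y₂ * y₁ * (L * R) ∎)
    where
    open ≡-Reasoning
    a≤b+1 : a ℕ.≤ suc b
    a≤b+1 = ℕP.≤-trans (ℕP.n≤1+n a) (ℕP.≤-trans a<b (ℕP.n≤1+n b))
    a+1≤b+1 : suc a ℕ.≤ suc b
    a+1≤b+1 = s≤s (ℕP.<⇒≤ a<b)
    b≤N : b ℕ.≤ N
    b≤N = ℕP.≤-trans b≤m (ℕP.n≤1+n m)
    r x s y₁ y₂ L R : Carrier
    r  = at ρπ a (suc b)
    x  = upWeight π a (suc b)
    s  = at π (suc a) b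
    y₁ = upWeight π a b
    y₂ = upWeight π (suc a) (suc b)
    L  = downWeight ρπ (suc a) (suc b)
    R  = downWeight ρπ a b
    L>0 : 0# < L
    L>0 = downWeight-pos (suc a) (suc b) (s≤s z≤n) a+1≤b+1 (s≤s b≤m)
    R>0 : 0# < R
    R>0 = downWeight-pos a b 1≤a (ℕP.<⇒≤ a<b) b≤N
    y₁R≡κ : y₁ * R ≡ κ
    y₁R≡κ = trans (*-comm y₁ R) (downWeight-upWeight a b 1≤a (ℕP.<⇒≤ a<b) b≤N)
    y₂L≡κ : y₂ * L ≡ κ
    y₂L≡κ = trans (*-comm y₂ L) (downWeight-upWeight (suc a) (suc b) (s≤s z≤n) a+1≤b+1 (s≤s b≤m))

  module Slice (i′ j : ℕ) (m≡i′+j : m ≡ i′ ℕ.+ j) where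
    open Hook F m i′ j m≡i′+j hiding (N)

    private
      β : ℕ → ℕ → Carrier
      β = upWeight π

      b≤m : ∀ {b} → InRange i j b → b ℕ.≤ m
      b≤m {b} (_ , b<i+j) = ℕP.≤-pred (subst (b ℕ.<_) (sym N≡i+j) b<i+j)

    ρColumn πColumn : ℕ → Carrier
    ρColumn b = prod (λ a → at ρπ a (suc b)) 1 i′
    πColumn b = prod (λ a → at π (suc a) b) 1 i′

    column-exchange : ∀ b → InRange i j b → ρColumn b * β i b * β 1 (suc b) ≡ πColumn b * β i (suc b) * β 1 b
    column-exchange b r@(i≤b , _) = trans (x*y*z≡x*z*y _ _ _) (prod-exchange _ _ (λ a → β a (suc b)) (λ a → β a b) 1 i′
      (λ a (1≤a , a<i) → upWeight-pos π π>0 a (suc b) 1≤a (ℕP.≤-trans (ℕP.<⇒≤ a<i) (ℕP.≤-trans i≤b (ℕP.n≤1+n b)))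
                                                         (s≤s (b≤m r)))
      (λ a (1≤a , a<i) → upWeight-pos π π>0 a b 1≤a (ℕP.≤-trans (ℕP.<⇒≤ a<i) i≤b) (ℕP.≤-trans (b≤m r) (ℕP.n≤1+n m)))
      (λ a (1≤a , a<i) → upWeight-exchange a b 1≤a (ℕP.<-≤-trans a<i i≤b) (b≤m r)))
      where
      x*y*z≡x*z*y : ∀ x y z → x * y * z ≡ x * z * y
      x*y*z≡x*z*y x y z = solve 3 (λ x y z → x :* y :* z := x :* z :* y) refl x y z

    rectangle-exchange : prod ρColumn i j * β i i * β 1 N ≡ prod πColumn i j * β i N * β 1 i
    rectangle-exchange = subst (λ t → prod ρColumn i j * β i i * β 1 t ≡ prod πColumn i j * β i t * β 1 i) (sym N≡i+j)
      (prod-exchange ρColumn πColumn (β i) (β 1) i j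
        (λ b r@(i≤b , _) → upWeight-pos π π>0 i b (s≤s z≤n) i≤b (ℕP.≤-trans (b≤m r) (ℕP.n≤1+n m)))
        (λ b r → upWeight-pos π π>0 1 b ℕP.≤-refl (ℕP.≤-trans (s≤s z≤n) (proj₁ r)) (ℕP.≤-trans (b≤m r) (ℕP.n≤1+n m)))
        column-exchange)

    rectangle-via-border : rectangle π * at π 1 N ≡ prod πColumn i j * β i N * β 1 i
    rectangle-via-border = begin
      rectangle π * at π 1 N
        ≡⟨ cong (_* at π 1 N) (prod-snoc column i j) ⟩
      prod column i j * column (i ℕ.+ j) * at π 1 N
        ≡⟨ cong (λ t → prod column i j * column t * at π 1 N) (sym N≡i+j) ⟩
      prod column i j * column N * at π 1 N
        ≡⟨ cong (λ t → t * column N * at π 1 N) columns ⟩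
      prod (at π 1) i j * prod πColumn i j * column N * at π 1 N
        ≡⟨ solve 4 (λ p q u v → p :* q :* u :* v := q :* u :* (p :* v)) refl (prod (at π 1) i j) (prod πColumn i j) (column N) (at π 1 N) ⟩
      prod πColumn i j * column N * (prod (at π 1) i j * at π 1 N)
        ≡⟨ cong₂ (λ u v → prod πColumn i j * u * v) (sym (upWeight-lastColumn π i′ (s≤s (subst (i′ ℕ.≤_) (sym m≡i′+j) (ℕP.m≤m+n i′ j)))))
             (sym (trans (upWeight-firstRow π j i (sym N≡i+j) (s≤s z≤n))
                         (trans (prod-snoc (at π 1) i j) (cong (λ t → prod (at π 1) i j * at π 1 t) (sym N≡i+j))))) ⟩
      prod πColumn i j * β i N * β 1 i ∎
      where
      open ≡-Reasoning
      column : ℕ → Carrier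
      column b = prod (λ a → at π a b) 1 i
      columns : prod column i j ≡ prod (at π 1) i j * prod πColumn i j
      columns = trans (prod-cong i j (λ b _ → cong (at π 1 b *_) (prod-shift (λ a → at π a b) 1 i′))) (prod-* (at π 1) πColumn i j)

    statistic-step : rowProd π * colProd π * at ρπ i i * innerProd π ≡ κ * at π i i * innerProd ρπ
    statistic-step = *-cancelʳ (β 1 N * β i i) (>0⇒≢0 (*-pos (upWeight-pos π π>0 1 N ℕP.≤-refl (s≤s z≤n) ℕP.≤-refl)
                                                             (upWeight-pos π π>0 i i (s≤s z≤n) ℕP.≤-refl i≤N))) (begin
      hook * at ρπ i i * innerProd π * (β 1 N * β i i)
        ≡⟨ solve 5 (λ w r q b₁ bᵢ → w :* r :* q :* (b₁ :* bᵢ) := w :* q :* b₁ :* (r :* bᵢ)) refl hook (at ρπ i i) (innerProd π) (β 1 N) (β i i) ⟩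
      hook * innerProd π * β 1 N * (at ρπ i i * β i i)
        ≡⟨ cong₂ (λ u v → hook * innerProd π * u * v) (upWeight-top π)
                 (trans (cong (_* β i i) (sym (downWeight-singleton ρπ i))) (downWeight-upWeight i i (s≤s z≤n) ℕP.≤-refl i≤N)) ⟩
      hook * innerProd π * at π 1 N * κ
        ≡⟨ cong (λ t → t * at π 1 N * κ) (sym (rectangle-via-hook π)) ⟩
      rectangle π * at π i i * at π 1 N * κ
        ≡⟨ solve 4 (λ r x y k → r :* x :* y :* k := x :* (r :* y) :* k) refl (rectangle π) (at π i i) (at π 1 N) κ ⟩
      at π i i * (rectangle π * at π 1 N) * κ
        ≡⟨ cong (λ t → at π i i * t * κ) (trans rectangle-via-border (sym rectangle-exchange)) ⟩
      at π i i * (prod ρColumn i j * β i i * β 1 N) * κ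
        ≡⟨ cong (λ t → at π i i * (t * β i i * β 1 N) * κ) (sym (prod-shift (λ b → prod (λ a → at ρπ a b) 1 i′) i j)) ⟩
      at π i i * (innerProd ρπ * β i i * β 1 N) * κ
        ≡⟨ solve 5 (λ x q bᵢ b₁ k → x :* (q :* bᵢ :* b₁) :* k := k :* x :* q :* (b₁ :* bᵢ)) refl (at π i i) (innerProd ρπ) (β i i) (β 1 N) κ ⟩
      κ * at π i i * innerProd ρπ * (β 1 N * β i i) ∎)
      where
      open ≡-Reasoning
      hook : Carrier
      hook = rowProd π * colProd π
      i≤N : i ℕ.≤ N
      i≤N = s≤s (subst (i′ ℕ.≤_) (sym m≡i′+j) (ℕP.m≤m+n i′ j))

corollary4p15 : (F : CompleteOrderedField) →
  let open CompleteOrderedField F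
      open Rowmotion F
  in (m : ℕ) → (κ : Carrier) → 0# < κ →
     (i : ℕ) → 1 ℕ.≤ i → i ℕ.≤ suc m →
     (π : Labelling (suc m)) → Positive π →
     (k : ℕ) → 1 ℕ.≤ k →
     rowmotion^ m κ k π ≈L π →
     (∀ l → 1 ℕ.≤ l → l ℕ.< k → ¬ (rowmotion^ m κ l π ≈L π)) →
     κ ^ k ≡ Π' (map (h m κ i) (orbitList m κ k π))
corollary4p15 F m κ κ>0 (suc i′) (s≤s z≤n) (s≤s i′≤m) π π>0 k _ ρᵏπ≈π _ = sym (begin
  Π' (map (h m κ i) (orbitList m κ k π))
    ≡⟨ Π'-applyUpTo (h m κ i) σ k ⟩
  prod (h m κ i ∘ σ) 0 k
    ≡⟨ prod-cong 0 k (λ l _ → statistic-hook κ (σ l)) ⟩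
  prod (λ l → rowProd (σ l) * colProd (σ l)) 0 k
    ≡⟨ prod-coboundary κ _ (diagonal ∘ σ) (innerProd ∘ σ) k diagonal>0 inner>0
                       (at-≈ ρᵏπ≈π i i) (innerProd-≈ ρᵏπ≈π) step ⟩
  κ ^ k ∎)
  where
  open CompleteOrderedField F
  open Rowmotion F
  open RangeProduct F
  open ChainSums F {suc m}
  open IntervalProducts F {suc m}
  j : ℕ
  j = m ℕ.∸ i′
  m≡i′+j : m ≡ i′ ℕ.+ j
  m≡i′+j = sym (ℕP.m+[n∸m]≡n i′≤m)
  open Hook F m i′ j m≡i′+j
  open ≡-Reasoning
  σ : ℕ → Labelling (suc m)
  σ l = rowmotion^ m κ l π
  σ>0 : ∀ l → Positive (σ l)
  σ>0 zero    = π>0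
  σ>0 (suc l) = RowmotionStep.rowmotion-pos F m κ κ>0 (σ l) (σ>0 l)
  diagonal : Labelling (suc m) → Carrier
  diagonal τ = at τ i i
  diagonal>0 : ∀ l → 0# < diagonal (σ l)
  diagonal>0 l = at-pos (σ l) i i (s≤s z≤n) ℕP.≤-refl (s≤s i′≤m) (λ J _ _ → σ>0 l J)
  inner>0 : ∀ l → 0# < innerProd (σ l)
  inner>0 l = innerProd-pos (σ l) (σ>0 l)
  step : ∀ l → rowProd (σ l) * colProd (σ l) * diagonal (σ (suc l)) * innerProd (σ l) ≡
               κ * diagonal (σ l) * innerProd (σ (suc l))
  step l = RowmotionStep.Slice.statistic-step F m κ κ>0 (σ l) (σ>0 l) i′ j m≡i′+j
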